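{- Let $\lambda=(\lambda_1,\dots,\lambda_\ell)\vdash n$ and let $\mathrm{SRT}_\lambda$ be the set of special rim hook tableaux of shape $\lambda$. The map $$\operatorname{perm}_{\mathrm{SRT}}:\mathrm{SRT}_\lambda\to\{\sigma\in S_\ell:\lambda_i-i+\sigma_i\ge0\text{ for all }i\in[\ell]\}$$ is a bijection. Moreover, if $R\in\mathrm{SRT}_\lambda$ and $\sigma=\operatorname{perm}_{\mathrm{SRT}}(R)$, then $\Gamma_i(R)=\lambda_i-i+\sigma_i$ for all $i\in[\ell]$.
   Context: For a partition $\lambda=(\lambda_1\ge\dots\ge\lambda_\ell>0)$, its Ferrers diagram is the set of cells $(i,j)$, $1\le i\le\ell$, $1\le j\le\lambda_i$ (row $i$ from the top). A rim hook is a connected skew diagram (difference of two Ferrers diagrams of partitions) containing no $2\times2$ square. A special rim hook tableau (SRT) of shape $\lambda$ is a partition of the diagram of $\lambda$ into rim hooks each containing a cell of the first column. The initial cell of a rim hook is its northeastern-most cell; the terminal cell is its southwestern-most cell. The $d$-th diagonal is $\mathcal L_d=\{(d+k,1+k):k\in\mathbb Z\}$; each diagonal contains at most one initial cell of an SRT. $\operatorname{perm}_{\mathrm{SRT}}(R)=\sigma\in S_\ell$ is defined for $i\in[\ell]$ by: if $\mathcal L_{i-\lambda_i+1}$ contains no initial cell, $\sigma_i=i-\lambda_i$; otherwise $\sigma_i$ is the row of the terminal cell of the rim hook whose initial cell lies in $\mathcal L_{i-\lambda_i+1}$. $\Gamma(R)=(\Gamma_1(R),\dots,\Gamma_\ell(R))$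 where $\Gamma_i(R)$ is the number of cells of the rim hook of $R$ whose initial cell lies on $\mathcal L_{i-\lambda_i+1}$, or $0$ if there is no such rim hook. -}

module Defs where

open import Data.Nat using (ℕ; zero; suc; _≤_; _<_)
open import Data.Integer as ℤ using (ℤ; +_)
open import Data.Product using (Σ; ∃; _×_; _,_; proj₁; proj₂)
open import Data.Sum using (_⊎_)
open import Data.Fin using (Fin; toℕ)
open import Data.Fin.Permutation using (Permutation′; _⟨$⟩ʳ_)
open import Data.List using (List; []; _∷_; length; lookup)
open import Data.List.Relation.Unary.All using (All)
open import Data.List.Relation.Unary.Linked using (Linked)
open import Data.List.Relation.Unary.Unique.Propositional using (Unique)
open import Data.List.Membership.Propositional using (_∈_)
open import Relation.Binary.PropositionalEquality using (_≡_)
open import Relation.Nullary using (¬_)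
open import Function.Bundles using (_⇔_)

-- Partitions and Ferrers diagrams (rows/columns are 1-indexed)

IsPartition : List ℕ → Set
IsPartition λ′ = All (0 <_) λ′ × Linked (λ a b → b ≤ a) λ′

rowLen : List ℕ → ℕ → ℕ
rowLen []       _             = 0
rowLen (x ∷ xs) zero          = 0
rowLen (x ∷ xs) (suc zero)    = x
rowLen (x ∷ xs) (suc (suc k)) = rowLen xs (suc k)

Cell : Set
Cell = ℕ × ℕ

row col : Cell → ℕ
row = proj₁
col = proj₂

-- (i , j) lies in the Ferrers diagram of λ  iff  1 ≤ j ≤ λ_i  (forces 1 ≤ i ≤ ℓ)
InDiagram : List ℕ → Cell → Set
InDiagram λ′ (i , j) = 1 ≤ j × j ≤ rowLen λ′ i

-- Rim hooks.  A finite set of cells is represented by a duplicate-free list.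

SameCells : List Cell → List Cell → Set
SameCells H H′ = ∀ c → (c ∈ H) ⇔ (c ∈ H′)

IsSkew : List Cell → Set
IsSkew H = Σ (List ℕ) λ μ → Σ (List ℕ) λ ν →
  IsPartition μ × IsPartition ν ×
  (∀ c → InDiagram ν c → InDiagram μ c) ×
  (∀ c → (c ∈ H) ⇔ (InDiagram μ c × ¬ InDiagram ν c))

Adjacent : Cell → Cell → Set
Adjacent (a , b) (c , d) =
  (a ≡ c × suc b ≡ d) ⊎ (a ≡ c × b ≡ suc d) ⊎
  (suc a ≡ c × b ≡ d) ⊎ (a ≡ suc c × b ≡ d)

data PathIn (H : List Cell) : Cell → Cell → Set where
  here : ∀ {c} → PathIn H c c
  step : ∀ {c c′ e} → Adjacent c c′ → c′ ∈ H → PathIn H c′ e → PathIn H c e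

Connected : List Cell → Set
Connected H = ∀ {c e} → c ∈ H → e ∈ H → PathIn H c e

No2x2 : List Cell → Set
No2x2 H = ¬ (Σ Cell λ { (a , b) →
  ((a , b) ∈ H) × ((suc a , b) ∈ H) × ((a , suc b) ∈ H) × ((suc a , suc b) ∈ H) })

IsRimHook : List Cell → Set
IsRimHook H = Unique H × Σ Cell (λ c → c ∈ H) × IsSkew H × Connected H × No2x2 H

MeetsFirstColumn : List Cell → Set
MeetsFirstColumn H = Σ ℕ λ i → (i , 1) ∈ H

record SRT (λ′ : List ℕ) : Set where
  field
    hooks    : List (List Cell)
    rimHook  : All IsRimHook hooks
    special  : All MeetsFirstColumn hooks
    inShape  : All (λ H → ∀ c → c ∈ H → InDiagram λ′ c) hooks
    covered  : ∀ c → InDiagram λ′ c → Σ (Fin (length hooks)) λ k → c ∈ lookup hooks k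
    disjoint : ∀ c (k k′ : Fin (length hooks)) →
               c ∈ lookup hooks k → c ∈ lookup hooks k′ → k ≡ k′

open SRT public

_≈SRT_ : ∀ {λ′} → SRT λ′ → SRT λ′ → Set
R ≈SRT R′ =
  (∀ {H} → H ∈ hooks R  → Σ (List Cell) λ H′ → H′ ∈ hooks R′ × SameCells H H′) ×
  (∀ {H} → H ∈ hooks R′ → Σ (List Cell) λ H′ → H′ ∈ hooks R  × SameCells H H′)

IsInitial : List Cell → Cell → Set
IsInitial H c = c ∈ H × (∀ e → e ∈ H → row c ≤ row e × col e ≤ col c)

IsTerminal : List Cell → Cell → Set
IsTerminal H c = c ∈ H × (∀ e → e ∈ H → row e ≤ row c × col c ≤ col e)

OnDiagonal : ℤ → Cell → Set
OnDiagonal d (a , b) = (+ a ℤ.- + b) ℤ.+ + 1 ≡ d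

InitialOn : ∀ {λ′} (R : SRT λ′) → ℤ → Fin (length (hooks R)) → Cell → Set
InitialOn R d k c = IsInitial (lookup (hooks R) k) c × OnDiagonal d c

HasInitialOn : ∀ {λ′} → SRT λ′ → ℤ → Set
HasInitialOn R d = Σ (Fin (length (hooks R))) λ k → Σ Cell λ c → InitialOn R d k c

rowOf : ∀ {ℓ} → Fin ℓ → ℕ
rowOf i = suc (toℕ i)

diagIndex : List ℕ → ℕ → ℤ
diagIndex λ′ i = (+ i ℤ.- + rowLen λ′ i) ℤ.+ + 1

-- σ = perm_SRT(R), with σ ∈ S_ℓ given as a permutation of Fin ℓ
-- (σ_i = rowOf (σ ⟨$⟩ʳ i))
PermSRT : (λ′ : List ℕ) → SRT λ′ → Permutation′ (length λ′) → Set
PermSRT λ′ R σ = ∀ (i : Fin (length λ′)) →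
  let r = rowOf i
      s = + rowOf (σ ⟨$⟩ʳ i)
  in (¬ HasInitialOn R (diagIndex λ′ r) × s ≡ + r ℤ.- + rowLen λ′ r)
     ⊎ (Σ (Fin (length (hooks R))) λ k → Σ Cell λ c → Σ Cell λ t →
          InitialOn R (diagIndex λ′ r) k c × IsTerminal (lookup (hooks R) k) t ×
          s ≡ + row t)

GammaIs : (λ′ : List ℕ) → SRT λ′ → ℕ → ℕ → Set
GammaIs λ′ R i g =
  (¬ HasInitialOn R (diagIndex λ′ i) × g ≡ 0)
  ⊎ (Σ (Fin (length (hooks R))) λ k → Σ Cell λ c →
       InitialOn R (diagIndex λ′ i) k c × g ≡ length (lookup (hooks R) k))

Admissible : (λ′ : List ℕ) → Permutation′ (length λ′) → Set
Admissible λ′ σ = ∀ (i : Fin (length λ′)) →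
  + 0 ℤ.≤ (+ rowLen λ′ (rowOf i) ℤ.- + rowOf i) ℤ.+ + rowOf (σ ⟨$⟩ʳ i)

{-# OPTIONS --safe #-}
module Submission where

-- Induction on the number ℓ of rows, with shapes given by row-length functions f.  If the last
-- row is empty, σ fixes ℓ and nothing changes.  Otherwise the hook H₀ through (ℓ , 1) is the
-- whole outer rim from some row end (a , f a) down to (ℓ , 1): the hook through a cell south-east
-- of H₀ would stay east of H₀ from diagonal to diagonal and reach the first column first.  Hence
-- H₀ is determined by a, has length f a − a + ℓ, and σ a = ℓ.  Removing H₀ leaves a tableau of a
-- shape whose row ends are those of f other than (a , f a), each moved along its own diagonal, so
-- the rest of perm_SRT is σ with a ↦ ℓ removed.  Conversely an admissible σ is realised by adding
-- the outer rim from row σ⁻¹ ℓ to a tableau realising the smaller permutation.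

open import Defs
open import Data.Nat using (ℕ; zero; suc; pred; _+_; _∸_; _≤_; _<_; _≤?_; _<?_; _≟_; z≤n; s≤s)
open import Data.Nat.Properties
open import Data.Nat.Tactic.RingSolver using (solve-∀)
open import Data.Nat.ListAction using (sum)
open import Data.Integer as ℤ using (+_)
import Data.Integer.Properties as ℤ
import Data.Integer.Tactic.RingSolver as ℤ-Solver
open import Algebra.Properties.CommutativeSemigroup +-commutativeSemigroup using (xy∙z≈xz∙y)
open import Data.Product using (Σ; _×_; _,_; proj₁; proj₂)
open import Data.Product.Properties using (≡-dec)
open import Data.Sum using (_⊎_; inj₁; inj₂; [_,_]′)
open import Data.Empty using (⊥; ⊥-elim)
open import Data.List using (List; []; _∷_; length; filter; lookup)
open import Data.List.Relation.Unary.All as All using (All; []; _∷_)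
open import Data.List.Relation.Unary.AllPairs using (AllPairs; []; _∷_)
open import Data.List.Relation.Unary.Linked using (Linked; []; [-]; _∷_)
open import Data.List.Relation.Unary.Any as Any using (here; there)
open import Data.List.Relation.Unary.Any.Properties using (lookup-index)
open import Data.List.Membership.Propositional using (_∈_)
open import Data.List.Membership.Propositional.Properties using (∈-filter⁺; ∈-filter⁻; ∈-lookup)
open import Data.List.Membership.DecPropositional (≡-dec _≟_ _≟_) using (_∈?_)
open import Data.List.Membership.Propositional.Properties.WithK using (unique∧set⇒bag)
open import Data.List.Relation.Binary.BagAndSetEquality using (∼bag⇒↭)
open import Data.List.Relation.Binary.Permutation.Propositional.Properties using (↭-length)
import Data.List.Relation.Unary.All.Properties as All
import Data.List.Relation.Unary.AllPairs.Properties as AllPairs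
open import Relation.Binary.PropositionalEquality
open import Relation.Binary.Definitions using (tri<; tri≈; tri>)
open import Relation.Nullary using (¬_; Dec; yes; no; ¬?)
open import Function.Bundles using (_⇔_; mk⇔; Equivalence)
open import Function.Base using (_∘_)
open import Function.Construct.Composition using (_⇔-∘_)
open import Data.Fin as Fin using (Fin; toℕ; fromℕ; fromℕ<; punchIn; punchOut)
import Data.Fin.Properties as Fin
open import Data.Fin.Properties using (toℕ-injective; toℕ-fromℕ; toℕ-fromℕ<; toℕ<n; punchIn-punchOut; punchInᵢ≢i)
import Data.Fin.Permutation as Perm
open import Data.Fin.Permutation
  using (Permutation′; _⟨$⟩ʳ_; _⟨$⟩ˡ_; inverseʳ; inverseˡ; remove; insert; insert-punchIn; punchIn-permute)

Antitone⁺ : (ℕ → ℕ) → Set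
Antitone⁺ f = ∀ {r r′} → 1 ≤ r → r ≤ r′ → f r′ ≤ f r

antitone⁺-stepwise : ∀ {f} → (∀ k → f (suc (suc k)) ≤ f (suc k)) → Antitone⁺ f
antitone⁺-stepwise {f} f-step {suc r} _ r≤r′ with m≤n⇒∃[o]m+o≡n r≤r′
... | d , refl = go d
  where
  go : ∀ d → f (suc r + d) ≤ f (suc r)
  go zero    = ≤-reflexive (cong f (+-identityʳ (suc r)))
  go (suc d) = ≤-trans (subst (λ x → f x ≤ f (suc r + d)) (sym (+-suc (suc r) d)) (f-step (r + d))) (go d)

rowLen-zero : ∀ λ′ → rowLen λ′ 0 ≡ 0
rowLen-zero []      = refl
rowLen-zero (_ ∷ _) = refl

rowLen-beyond : ∀ λ′ r → length λ′ < r → rowLen λ′ r ≡ 0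
rowLen-beyond []       zero          _         = refl
rowLen-beyond []       (suc r)       _         = refl
rowLen-beyond (_ ∷ λ′) (suc (suc r)) (s≤s lt)  = rowLen-beyond λ′ (suc r) lt

rowLen-antitone⁺ : ∀ {λ′} → Linked (λ a b → b ≤ a) λ′ → Antitone⁺ (rowLen λ′)
rowLen-antitone⁺ linked = antitone⁺-stepwise (rowLen-step linked)
  where
  rowLen-step : ∀ {λ′} → Linked (λ a b → b ≤ a) λ′ → ∀ k → rowLen λ′ (suc (suc k)) ≤ rowLen λ′ (suc k)
  rowLen-step []           _       = z≤n
  rowLen-step [-]          _       = z≤n
  rowLen-step (y≤x ∷ _)    zero    = y≤x
  rowLen-step (_ ∷ linked) (suc k) = rowLen-step linked k

-- Shapes are handled as row-length functions, so that removing an outer rim yields a shape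
-- again; row 0 and the rows beyond ℓ are empty.
record Shape (ℓ : ℕ) (f : ℕ → ℕ) : Set where
  field
    row-zero : f 0 ≡ 0
    antitone : Antitone⁺ f
    vanishes : ∀ r → ℓ < r → f r ≡ 0

partition-shape : ∀ {λ′} → IsPartition λ′ → Shape (length λ′) (rowLen λ′)
partition-shape {λ′} (_ , linked) = record
  { row-zero = rowLen-zero λ′ ; antitone = rowLen-antitone⁺ linked ; vanishes = rowLen-beyond λ′ }

InShape : (ℕ → ℕ) → Cell → Set
InShape f (i , j) = 1 ≤ j × j ≤ f i

diagram-of : ∀ μ {f} → (∀ r → rowLen μ r ≡ f r) → ∀ {c} → InDiagram μ c ⇔ InShape f c
diagram-of _ same {i , j} = mk⇔ (λ (1≤j , j≤) → 1≤j , subst (j ≤_) (same i) j≤)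
                             (λ (1≤j , j≤) → 1≤j , subst (j ≤_) (sym (same i)) j≤)

-- c ≼ e: the diagonal row − col of c is at most that of e, stated without subtraction.
record _≼_ (c e : Cell) : Set where
  constructor mk≼
  field cross : row c + col e ≤ row e + col c

open _≼_

SameDiagonal : Cell → Cell → Set
SameDiagonal c e = row c + col e ≡ row e + col c

≼-refl : ∀ {c} → c ≼ c
≼-refl = mk≼ ≤-refl

≼-total : ∀ c e → c ≼ e ⊎ e ≼ c
≼-total c e with ≤-total (row c + col e) (row e + col c)
... | inj₁ le = inj₁ (mk≼ le)
... | inj₂ ge = inj₂ (mk≼ ge)

≼-trans : ∀ {c e g} → c ≼ e → e ≼ g → c ≼ g
≼-trans {rc , cc} {re , ce} {rg , cg} (mk≼ p) (mk≼ q) =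
  mk≼ (+-cancelʳ-≤ (re + ce) (rc + cg) (rg + cc) (subst₂ _≤_ (shuffle rc cg re ce) (shuffle′ rg cc re ce) (+-mono-≤ p q)))
  where
  shuffle : ∀ rc cg re ce → rc + ce + (re + cg) ≡ rc + cg + (re + ce)
  shuffle = solve-∀
  shuffle′ : ∀ rg cc re ce → re + cc + (rg + ce) ≡ rg + cc + (re + ce)
  shuffle′ = solve-∀

≼-antisym : ∀ {c e} → c ≼ e → e ≼ c → SameDiagonal c e
≼-antisym (mk≼ p) (mk≼ q) = ≤-antisym p q

same-diagonal-< : ∀ {a b c d} → SameDiagonal (a , b) (c , d) → a < c → b < d
same-diagonal-< {a} {b} {c} {d} same a<c with b <? d
... | yes b<d = b<d
... | no b≮d  = ⊥-elim (<⇒≱ (+-mono-<-≤ a<c (≮⇒≥ b≮d)) (≤-reflexive (sym same)))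

same-diagonal-trans : ∀ {c d e} → SameDiagonal c d → SameDiagonal d e → SameDiagonal c e
same-diagonal-trans {a , b} {c , d} {e , f} cd de = +-cancelʳ-≡ (c + d) _ _ (begin
  a + f + (c + d) ≡⟨ shuffle a f c d ⟩
  a + d + (c + f) ≡⟨ cong₂ _+_ cd de ⟩
  c + b + (e + d) ≡⟨ shuffle′ c b e d ⟩
  e + b + (c + d) ∎)
  where
  open ≡-Reasoning
  shuffle : ∀ a f c d → a + f + (c + d) ≡ a + d + (c + f)
  shuffle = solve-∀
  shuffle′ : ∀ c b e d → c + b + (e + d) ≡ e + b + (c + d)
  shuffle′ = solve-∀

same-diagonal-col : ∀ {c e} → SameDiagonal c e → col c ≡ col e → c ≡ e
same-diagonal-col {a , b} {c , .b} same refl = cong (_, b) (+-cancelʳ-≡ b a c same)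

_≺_ : Cell → Cell → Set
c ≺ e = suc (row c + col e) ≤ row e + col c

NextDiagonal : Cell → Cell → Set
NextDiagonal c c′ = row c′ + col c ≡ suc (row c + col c′)

next-diagonal-≺ : ∀ {c c′ e} → NextDiagonal c c′ → c′ ≼ e → c ≺ e
next-diagonal-≺ {rc , cc} {rc′ , cc′} {re , ce} next (mk≼ le) =
  +-cancelʳ-≤ cc′ _ _ (subst₂ _≤_ (trans (swap rc′ ce cc) (trans (cong (_+ ce) next) (swap′ rc cc′ ce))) (swap re cc′ cc)
    (+-monoˡ-≤ cc le))
  where
  swap : ∀ x y z → x + y + z ≡ x + z + y
  swap = solve-∀
  swap′ : ∀ x y z → suc (x + y) + z ≡ suc (x + z) + y
  swap′ = solve-∀

next-diagonal-same : ∀ {p q p′ q′} → SameDiagonal p q → NextDiagonal p p′ → NextDiagonal q q′ → SameDiagonal p′ q′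
next-diagonal-same {p} {q} {p′} {q′} pq pp′ qq′ =
  same-diagonal-trans {p′} {suc (row p) , col p} pp′
    (same-diagonal-trans {_} {suc (row q) , col q} {q′} (cong suc pq) (sym qq′))

DiagonalsAfter : Cell → ℕ → Cell → Set
DiagonalsAfter c d e = row c + d + col e ≡ row e + col c

diagonals-after-zero : ∀ {c e} → DiagonalsAfter c 0 e → SameDiagonal c e
diagonals-after-zero {c} = trans (cong (_+ _) (sym (+-identityʳ (row c))))

diagonals-after-next : ∀ {q q′ e d} → DiagonalsAfter q (suc d) e → NextDiagonal q q′ → DiagonalsAfter q′ d e
diagonals-after-next {rq , cq} {rq′ , cq′} {re , ce} {d} gap next = +-cancelʳ-≡ cq _ _ (begin
  rq′ + d + ce + cq          ≡⟨ shuffle rq′ d ce cq ⟩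
  rq′ + cq + (d + ce)        ≡⟨ cong (_+ (d + ce)) next ⟩
  suc (rq + cq′) + (d + ce)  ≡⟨ shuffle′ rq cq′ d ce ⟩
  rq + suc d + ce + cq′      ≡⟨ cong (_+ cq′) gap ⟩
  re + cq + cq′              ≡⟨ xy∙z≈xz∙y re cq cq′ ⟩
  re + cq′ + cq              ∎)
  where
  open ≡-Reasoning
  shuffle : ∀ rq′ d ce cq → rq′ + d + ce + cq ≡ rq′ + cq + (d + ce)
  shuffle = solve-∀
  shuffle′ : ∀ rq cq′ d ce → suc (rq + cq′) + (d + ce) ≡ rq + suc d + ce + cq′
  shuffle′ = solve-∀

≼⇒diagonals-after : ∀ {c e} → c ≼ e → Σ ℕ λ d → DiagonalsAfter c d e
≼⇒diagonals-after {c} {e} (mk≼ le) with m≤n⇒∃[o]m+o≡n le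
... | d , gap = d , trans (xy∙z≈xz∙y (row c) d (col e)) gap

adjacent-sym : ∀ {c e} → Adjacent c e → Adjacent e c
adjacent-sym (inj₁ (refl , refl))                = inj₂ (inj₁ (refl , refl))
adjacent-sym (inj₂ (inj₁ (refl , refl)))         = inj₁ (refl , refl)
adjacent-sym (inj₂ (inj₂ (inj₁ (refl , refl)))) = inj₂ (inj₂ (inj₂ (refl , refl)))
adjacent-sym (inj₂ (inj₂ (inj₂ (refl , refl)))) = inj₂ (inj₂ (inj₁ (refl , refl)))

path-∷ : ∀ {H x c e} → PathIn H c e → PathIn (x ∷ H) c e
path-∷ here              = here
path-∷ (step adj e∈ path) = step adj (there e∈) (path-∷ path)

path-snoc : ∀ {H c e e′} → PathIn H c e → Adjacent e e′ → e′ ∈ H → PathIn H c e′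
path-snoc here               adj e′∈ = step adj e′∈ here
path-snoc (step adj₀ e∈ path) adj e′∈ = step adj₀ e∈ (path-snoc path adj e′∈)

path-++ : ∀ {H c e g} → PathIn H c e → PathIn H e g → PathIn H c g
path-++ here               q = q
path-++ (step adj e∈ path) q = step adj e∈ (path-++ path q)

-- One step to an adjacent cell changes the diagonal by exactly one.
adjacent-≼ : ∀ {c c′ z} → Adjacent c c′ → c ≺ z → c′ ≼ z
adjacent-≼ {a , b} {z = rz , cz} (inj₁ (refl , refl)) lt = mk≼ (≤-trans (n≤1+n _) (≤-trans lt (+-monoʳ-≤ rz (n≤1+n b))))
adjacent-≼ {a , b} {z = rz , cz} (inj₂ (inj₁ (refl , refl))) lt = mk≼ (≤-pred (subst (suc (a + cz) ≤_) (+-suc rz _) lt))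
adjacent-≼ (inj₂ (inj₂ (inj₁ (refl , refl)))) lt = mk≼ lt
adjacent-≼ (inj₂ (inj₂ (inj₂ (refl , refl)))) lt = mk≼ (≤-trans (≤-trans (n≤1+n _) (n≤1+n _)) lt)

path-meets-diagonals : ∀ {H c e z} → c ∈ H → PathIn H c e → c ≼ z → z ≼ e → Σ Cell λ p → p ∈ H × SameDiagonal p z
path-meets-diagonals {c = c} c∈ here cz ze = c , c∈ , ≼-antisym cz ze
path-meets-diagonals {c = c} {z = z} c∈ (step adj c′∈ path) cz ze with row c + col z ≟ row z + col c
... | yes same = c , c∈ , same
... | no differ = path-meets-diagonals c′∈ path (adjacent-≼ adj (≤∧≢⇒< (cross cz) differ)) ze

module Least {A : Set} (_≤ₐ_ : A → A → Set) (total : ∀ x y → x ≤ₐ y ⊎ y ≤ₐ x)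
             (trans′ : ∀ {x y z} → x ≤ₐ y → y ≤ₐ z → x ≤ₐ z) (refl′ : ∀ {x} → x ≤ₐ x) where

  least-∷ : ∀ x xs → Σ A λ m → m ∈ (x ∷ xs) × (∀ y → y ∈ (x ∷ xs) → m ≤ₐ y)
  least-∷ x [] = x , here refl , λ { _ (here refl) → refl′ }
  least-∷ x (z ∷ zs) with least-∷ z zs
  ... | m , m∈ , m≤ with total x m
  ... | inj₁ x≤m = x , here refl , λ { _ (here refl) → refl′ ; y (there y∈) → trans′ x≤m (m≤ y y∈) }
  ... | inj₂ m≤x = m , there m∈ , λ { _ (here refl) → m≤x ; y (there y∈) → m≤ y y∈ }

  least : ∀ {xs z} → z ∈ xs → Σ A λ m → m ∈ xs × (∀ y → y ∈ xs → m ≤ₐ y)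
  least {x ∷ xs} _ = least-∷ x xs

initial-unique : ∀ {H c c′} → IsInitial H c → IsInitial H c′ → c ≡ c′
initial-unique (c∈ , c≤) (c′∈ , c′≤) =
  cong₂ _,_ (≤-antisym (proj₁ (c≤ _ c′∈)) (proj₁ (c′≤ _ c∈))) (≤-antisym (proj₂ (c′≤ _ c∈)) (proj₂ (c≤ _ c′∈)))

terminal-unique : ∀ {H c c′} → IsTerminal H c → IsTerminal H c′ → c ≡ c′
terminal-unique (c∈ , c≥) (c′∈ , c′≥) =
  cong₂ _,_ (≤-antisym (proj₁ (c′≥ _ c∈)) (proj₁ (c≥ _ c′∈))) (≤-antisym (proj₂ (c≥ _ c′∈)) (proj₂ (c′≥ _ c∈)))

module RimHook {H : List Cell} (rh : IsRimHook H) where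
  private
    skew = proj₁ (proj₂ (proj₂ rh))
    μ = proj₁ skew
    ν = proj₁ (proj₂ skew)
    μ-antitone = rowLen-antitone⁺ (proj₂ (proj₁ (proj₂ (proj₂ skew))))
    ν-antitone = rowLen-antitone⁺ (proj₂ (proj₁ (proj₂ (proj₂ (proj₂ skew)))))
    no2x2 : No2x2 H
    no2x2 = proj₂ (proj₂ (proj₂ (proj₂ rh)))

    ∈⇒skew : ∀ {a b} → (a , b) ∈ H → InDiagram μ (a , b) × ¬ InDiagram ν (a , b)
    ∈⇒skew = Equivalence.to (proj₂ (proj₂ (proj₂ (proj₂ (proj₂ skew)))) _)

    skew⇒∈ : ∀ {a b} → InDiagram μ (a , b) × ¬ InDiagram ν (a , b) → (a , b) ∈ H
    skew⇒∈ = Equivalence.from (proj₂ (proj₂ (proj₂ (proj₂ (proj₂ skew)))) _)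

  connected : Connected H
  connected = proj₁ (proj₂ (proj₂ (proj₂ rh)))

  col-pos : ∀ {a b} → (a , b) ∈ H → 1 ≤ b
  col-pos c∈ = proj₁ (proj₁ (∈⇒skew c∈))

  row-pos : ∀ {a b} → (a , b) ∈ H → 1 ≤ a
  row-pos {zero} {b} c∈ = ⊥-elim (<⇒≱ (col-pos c∈) (subst (b ≤_) (rowLen-zero μ) (proj₂ (proj₁ (∈⇒skew c∈)))))
  row-pos {suc a} _     = s≤s z≤n

  rectangle-⊆ : ∀ {a b a′ b′ x y} → (a , b) ∈ H → (a′ , b′) ∈ H →
                a ≤ x → x ≤ a′ → b ≤ y → y ≤ b′ → (x , y) ∈ H
  rectangle-⊆ c∈ c′∈ a≤x x≤a′ b≤y y≤b′ = skew⇒∈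
    ( (≤-trans (col-pos c∈) b≤y
      , ≤-trans y≤b′ (≤-trans (proj₂ (proj₁ (∈⇒skew c′∈))) (μ-antitone (≤-trans (row-pos c∈) a≤x) x≤a′)))
    , λ (_ , y≤ν) → proj₂ (∈⇒skew c∈) (col-pos c∈ , ≤-trans b≤y (≤-trans y≤ν (ν-antitone (row-pos c∈) a≤x))) )

  no-south-east-pair : ∀ {a b a′ b′} → (a , b) ∈ H → (a′ , b′) ∈ H → a < a′ → b < b′ → ⊥
  no-south-east-pair {a} {b} c∈ c′∈ a<a′ b<b′ = no2x2 ((a , b) , c∈
    , rectangle-⊆ c∈ c′∈ (n≤1+n a) a<a′ ≤-refl (<⇒≤ b<b′)
    , rectangle-⊆ c∈ c′∈ ≤-refl (<⇒≤ a<a′) (n≤1+n b) b<b′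
    , rectangle-⊆ c∈ c′∈ (n≤1+n a) a<a′ (n≤1+n b) b<b′)

  ≼⇒south-west : ∀ {a b c d} → (a , b) ∈ H → (c , d) ∈ H → (a , b) ≼ (c , d) → a ≤ c × d ≤ b
  ≼⇒south-west {a} {b} {c} {d} ab∈ cd∈ (mk≼ ad≤cb) = a≤c , d≤b
    where
    a≤c : a ≤ c
    a≤c with c <? a | b ≤? d
    ... | no c≮a  | _      = ≮⇒≥ c≮a
    ... | yes c<a | yes b≤d = ⊥-elim (<⇒≱ (+-mono-<-≤ c<a b≤d) ad≤cb)
    ... | yes c<a | no b≰d  = ⊥-elim (no-south-east-pair cd∈ ab∈ c<a (≰⇒> b≰d))
    d≤b : d ≤ b
    d≤b with b <? d | c ≤? a
    ... | no b≮d  | _       = ≮⇒≥ b≮d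
    ... | yes b<d | yes c≤a = ⊥-elim (<⇒≱ (+-mono-≤-< c≤a b<d) ad≤cb)
    ... | yes b<d | no c≰a  = ⊥-elim (no-south-east-pair ab∈ cd∈ (≰⇒> c≰a) b<d)

  diagonal-injective : ∀ {p q} → p ∈ H → q ∈ H → SameDiagonal p q → p ≡ q
  diagonal-injective p∈ q∈ same =
    let (a≤c , d≤b) = ≼⇒south-west p∈ q∈ (mk≼ (≤-reflexive same))
        (c≤a , b≤d) = ≼⇒south-west q∈ p∈ (mk≼ (≤-reflexive (sym same)))
    in cong₂ _,_ (≤-antisym a≤c c≤a) (≤-antisym b≤d d≤b)

  next-diagonal : ∀ {a b c d} → (a , b) ∈ H → (c , d) ∈ H → c + b ≡ suc (a + d) →
                  (c ≡ suc a × d ≡ b) ⊎ (c ≡ a × b ≡ suc d)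
  next-diagonal {a} {b} {c} {d} ab∈ cd∈ next
    with ≼⇒south-west ab∈ cd∈ (mk≼ (≤-trans (n≤1+n _) (≤-reflexive (sym next))))
  ... | a≤c , d≤b with m≤n⇒∃[o]m+o≡n a≤c | m≤n⇒∃[o]m+o≡n d≤b
  ... | u , refl | v , refl =
    one-step u v (+-cancelˡ-≡ (a + d) (u + v) 1 (trans (shuffle a d u v) (trans next (sym (+-comm (a + d) 1)))))
    where
    shuffle : ∀ a d u v → a + d + (u + v) ≡ a + u + (d + v)
    shuffle = solve-∀
    one-step : ∀ u v → u + v ≡ 1 → (a + u ≡ suc a × d ≡ d + v) ⊎ (a + u ≡ a × d + v ≡ suc d)
    one-step 1 0 _ = inj₁ (+-comm a 1 , sym (+-identityʳ d))
    one-step 0 1 _ = inj₂ (+-identityʳ a , +-comm d 1)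
    one-step 0             0             ()
    one-step 0             (suc (suc _)) ()
    one-step 1             (suc _)       ()
    one-step (suc (suc _)) _             ()

  meets-diagonals : ∀ {c e z} → c ∈ H → e ∈ H → c ≼ z → z ≼ e → Σ Cell λ p → p ∈ H × SameDiagonal p z
  meets-diagonals c∈ e∈ = path-meets-diagonals c∈ (connected c∈ e∈)

  private
    nonempty = proj₂ (proj₁ (proj₂ rh))
    module NE = Least _≼_ ≼-total ≼-trans ≼-refl
    module SW = Least (λ x y → y ≼ x) (λ x y → ≼-total y x) (λ p q → ≼-trans q p) ≼-refl

  initial-exists : Σ Cell (IsInitial H)
  initial-exists with NE.least nonempty
  ... | c , c∈ , c≼ = c , c∈ , λ e e∈ → ≼⇒south-west c∈ e∈ (c≼ e e∈)

  terminal-exists : Σ Cell (IsTerminal H)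
  terminal-exists with SW.least nonempty
  ... | c , c∈ , ≼c = c , c∈ , λ e e∈ → ≼⇒south-west e∈ c∈ (≼c e e∈)

OnRim : (ℕ → ℕ) → Cell → Set
OnRim f c = f (suc (row c)) ≤ col c

rimStep : (ℕ → ℕ) → Cell → Cell
rimStep f (x , y) with y ≤? f (suc x)
... | yes _ = (suc x , y)
... | no _  = (x , pred y)

rimWalk : (ℕ → ℕ) → ℕ → Cell → List Cell
rimWalk f zero    c = c ∷ []
rimWalk f (suc n) c = c ∷ rimWalk f n (rimStep f c)

rimWalk-head : ∀ f n c → c ∈ rimWalk f n c
rimWalk-head f zero    c = here refl
rimWalk-head f (suc n) c = here refl

length-rimWalk : ∀ f n c → length (rimWalk f n c) ≡ suc n
length-rimWalk f zero    c = refl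
length-rimWalk f (suc n) c = cong suc (length-rimWalk f n (rimStep f c))

module ShapeGeometry {ℓ : ℕ} {f : ℕ → ℕ} (S : Shape ℓ f) where
  open Shape S

  inShape-rows : ∀ {c} → InShape f c → 1 ≤ row c × row c ≤ ℓ
  inShape-rows {zero , y} (1≤y , y≤f0) = ⊥-elim (<⇒≱ 1≤y (subst (y ≤_) row-zero y≤f0))
  inShape-rows {suc x , y} (1≤y , y≤fx) = s≤s z≤n , x<ℓ
    where
    x<ℓ : suc x ≤ ℓ
    x<ℓ with suc x ≤? ℓ
    ... | yes x<ℓ = x<ℓ
    ... | no x≮ℓ  = ⊥-elim (<⇒≱ 1≤y (subst (y ≤_) (vanishes (suc x) (≰⇒> x≮ℓ)) y≤fx))

  rim-diagonal-injective : ∀ {e w} → InShape f e → OnRim f e → InShape f w → OnRim f w → SameDiagonal e w → e ≡ w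
  rim-diagonal-injective {p , q} {p′ , q′} e∈ e-rim w∈ w-rim same with <-cmp p p′
  ... | tri≈ _ refl _ = cong (p ,_) (sym (+-cancelˡ-≡ p q′ q same))
  ... | tri< p<p′ _ _ =
    ⊥-elim (<⇒≱ (≤-trans (same-diagonal-< same p<p′) (≤-trans (proj₂ w∈) (antitone (s≤s z≤n) p<p′))) e-rim)
  ... | tri> _ _ p′<p =
    ⊥-elim (<⇒≱ (≤-trans (same-diagonal-< (sym same) p′<p) (≤-trans (proj₂ e∈) (antitone (s≤s z≤n) p′<p))) w-rim)

  -- From a rim cell, step down while possible and left otherwise; with a nonempty last row
  -- this stays on the rim and ends at (ℓ , 1).
  module RimWalk (last-nonempty : 1 ≤ f ℓ) where

    -- c is a rim cell lying n diagonals before (ℓ , 1)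
    RimBefore : ℕ → Cell → Set
    RimBefore n c = InShape f c × OnRim f c × row c + suc n ≡ ℓ + col c

    rimStep-spec : ∀ n c → RimBefore (suc n) c →
      RimBefore n (rimStep f c) × Adjacent c (rimStep f c) × NextDiagonal c (rimStep f c) × row c ≤ row (rimStep f c)
    rimStep-spec n (x , y) (c∈ , rim , before) with y ≤? f (suc x)
    ... | yes y≤ = ((proj₁ c∈ , y≤) , ≤-trans (antitone (s≤s z≤n) (n≤1+n _)) rim , trans (sym (+-suc x (suc n))) before)
                   , inj₂ (inj₂ (inj₁ (refl , refl))) , refl , n≤1+n x
    rimStep-spec n (x , zero)          ((() , _) , _)  | no _
    rimStep-spec n (x , suc zero)      (_ , _ , before) | no y≰ =
      ⊥-elim (<⇒≱ (≤-trans last-nonempty (antitone (s≤s z≤n) x<ℓ)) (≤-pred (≰⇒> y≰)))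
      where
      x<ℓ : suc x ≤ ℓ
      x<ℓ = subst (suc x ≤_) (suc-injective (trans (sym (+-suc x (suc n))) (trans before (+-comm ℓ 1))))
              (≤-trans (s≤s (m≤m+n x n)) (≤-reflexive (sym (+-suc x n))))
    rimStep-spec n (x , suc (suc y)) (c∈ , _ , before) | no y≰ =
      ((s≤s z≤n , ≤-trans (n≤1+n _) (proj₂ c∈)) , ≤-pred (≰⇒> y≰)
      , suc-injective (trans (sym (+-suc x (suc n))) (trans before (+-suc ℓ (suc y)))))
      , inj₂ (inj₁ (refl , refl)) , +-suc x (suc y) , ≤-refl

    rimWalk-sound : ∀ n c → RimBefore n c → ∀ {e} → e ∈ rimWalk f n c →
                    InShape f e × OnRim f e × c ≼ e × row c ≤ row e
    rimWalk-sound zero    c (c∈ , rim , _) (here refl) = c∈ , rim , ≼-refl , ≤-refl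
    rimWalk-sound (suc n) c (c∈ , rim , _) (here refl) = c∈ , rim , ≼-refl , ≤-refl
    rimWalk-sound (suc n) c before (there e∈) with rimStep-spec n c before
    ... | before′ , _ , next , down with rimWalk-sound n (rimStep f c) before′ e∈
    ... | e-in , e-rim , c′≼e , row≤ =
      e-in , e-rim , mk≼ (<⇒≤ (next-diagonal-≺ next c′≼e)) , ≤-trans down row≤

    rimWalk-unique : ∀ n c → RimBefore n c → AllPairs _≢_ (rimWalk f n c)
    rimWalk-unique zero    c _      = [] ∷ []
    rimWalk-unique (suc n) c before with rimStep-spec n c before
    ... | before′ , _ , next , _ = All.tabulate later-≢ ∷ rimWalk-unique n (rimStep f c) before′
      where
      later-≢ : ∀ {e} → e ∈ rimWalk f n (rimStep f c) → c ≢ e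
      later-≢ e∈ refl = <-irrefl refl (next-diagonal-≺ next (proj₁ (proj₂ (proj₂ (rimWalk-sound n _ before′ e∈)))))

    rimWalk-complete : ∀ n c → RimBefore n c → ∀ {z} → c ≼ z → z ≼ (ℓ , 1) →
                       Σ Cell λ e → e ∈ rimWalk f n c × SameDiagonal e z
    rimWalk-complete zero c (_ , _ , before) c≼z z≼end =
      c , here refl , ≼-antisym c≼z (≼-trans z≼end (mk≼ (≤-reflexive (sym before))))
    rimWalk-complete (suc n) c before {z} c≼z z≼end with row c + col z ≟ row z + col c
    ... | yes same = c , here refl , same
    ... | no differ with rimStep-spec n c before
    ... | before′ , adj , _
      with rimWalk-complete n (rimStep f c) before′ (adjacent-≼ adj (≤∧≢⇒< (cross c≼z) differ)) z≼end
    ... | e , e∈ , same = e , there e∈ , same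

    rimWalk-connected : ∀ n c → RimBefore n c → Connected (rimWalk f n c)
    rimWalk-connected n c before d∈ e∈ = path-++ (to-head n c before d∈) (from-head n c before e∈)
      where
      from-head : ∀ n c → RimBefore n c → ∀ {e} → e ∈ rimWalk f n c → PathIn (rimWalk f n c) c e
      from-head zero    c _ (here refl) = here
      from-head (suc n) c _ (here refl) = here
      from-head (suc n) c before (there e∈) with rimStep-spec n c before
      ... | before′ , adj , _ = step adj (there (rimWalk-head f n _)) (path-∷ (from-head n _ before′ e∈))
      to-head : ∀ n c → RimBefore n c → ∀ {e} → e ∈ rimWalk f n c → PathIn (rimWalk f n c) e c
      to-head zero    c _ (here refl) = here
      to-head (suc n) c _ (here refl) = here
      to-head (suc n) c before (there e∈) with rimStep-spec n c before
      ... | before′ , adj , _ = path-snoc (path-∷ (to-head n _ before′ e∈)) (adjacent-sym adj) (here refl)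

    rimWalk-no2x2 : ∀ n c → RimBefore n c → No2x2 (rimWalk f n c)
    rimWalk-no2x2 n c before (_ , top-left , _ , _ , bottom-right) =
      <⇒≱ (proj₂ (proj₁ (rimWalk-sound n c before bottom-right))) (proj₁ (proj₂ (rimWalk-sound n c before top-left)))

    module OuterRim (a : ℕ) (1≤a : 1 ≤ a) (a≤ℓ : a ≤ ℓ) where

      private
        1≤fa : 1 ≤ f a
        1≤fa = ≤-trans last-nonempty (antitone 1≤a a≤ℓ)

        steps : ℕ
        steps = ℓ + f a ∸ suc a

        steps-spec : a + suc steps ≡ ℓ + f a
        steps-spec = trans (+-suc a steps) (m+[n∸m]≡n (subst (_≤ ℓ + f a) (+-comm a 1) (+-mono-≤ a≤ℓ 1≤fa)))

        start : RimBefore steps (a , f a)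
        start = (1≤fa , ≤-refl) , antitone 1≤a (n≤1+n a) , steps-spec

      outerRim : List Cell
      outerRim = rimWalk f steps (a , f a)

      outerRim-sound : ∀ {e} → e ∈ outerRim → InShape f e × OnRim f e × a ≤ row e
      outerRim-sound e∈ with rimWalk-sound steps _ start e∈
      ... | e-in , e-rim , _ , a≤e = e-in , e-rim , a≤e

      outerRim-complete : ∀ {e} → InShape f e → OnRim f e → a ≤ row e → e ∈ outerRim
      outerRim-complete {p , q} e-in e-rim a≤p
        with rimWalk-complete steps _ start (mk≼ (+-mono-≤ a≤p (≤-trans (proj₂ e-in) (antitone 1≤a a≤p))))
                                             (mk≼ (+-mono-≤ (proj₂ (inShape-rows e-in)) (proj₁ e-in)))
      ... | w , w∈ , same with rimWalk-sound steps _ start w∈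
      ... | w-in , w-rim , _ = subst (_∈ outerRim) (rim-diagonal-injective w-in w-rim e-in e-rim same) w∈

      outerRim-unique : AllPairs _≢_ outerRim
      outerRim-unique = rimWalk-unique steps _ start

      outerRim-connected : Connected outerRim
      outerRim-connected = rimWalk-connected steps _ start

      outerRim-no2x2 : No2x2 outerRim
      outerRim-no2x2 = rimWalk-no2x2 steps _ start

      length-outerRim : length outerRim + a ≡ f a + ℓ
      length-outerRim = begin
        length outerRim + a ≡⟨ cong (_+ a) (length-rimWalk f steps _) ⟩
        suc steps + a       ≡⟨ +-comm (suc steps) a ⟩
        a + suc steps       ≡⟨ steps-spec ⟩
        ℓ + f a             ≡⟨ +-comm ℓ (f a) ⟩
        f a + ℓ             ∎
        where open ≡-Reasoning

      outerRim-first : (a , f a) ∈ outerRim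
      outerRim-first = rimWalk-head f steps _

      outerRim-last : (ℓ , 1) ∈ outerRim
      outerRim-last = outerRim-complete (≤-refl , last-nonempty) (subst (_≤ 1) (sym (vanishes (suc ℓ) ≤-refl)) z≤n) a≤ℓ

      outerRim-initial : IsInitial outerRim (a , f a)
      outerRim-initial = outerRim-first , λ e e∈ →
        let (e-in , _ , a≤e) = outerRim-sound e∈ in a≤e , ≤-trans (proj₂ e-in) (antitone 1≤a a≤e)

      outerRim-terminal : IsTerminal outerRim (ℓ , 1)
      outerRim-terminal = outerRim-last , λ e e∈ →
        let (e-in , _ , _) = outerRim-sound e∈ in proj₂ (inShape-rows e-in) , proj₁ e-in

-- The shape left by the outer rim from row a on: a row r ≥ a keeps the cells lying above
-- a cell of row r + 1 other than its last one.
peel : (ℕ → ℕ) → ℕ → ℕ → ℕ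
peel f a r with r <? a
... | yes _ = f r
... | no _  = pred (f (suc r))

peel-< : ∀ f {a r} → r < a → peel f a r ≡ f r
peel-< f {a} {r} r<a with r <? a
... | yes _   = refl
... | no r≮a  = ⊥-elim (r≮a r<a)

peel-≥ : ∀ f {a r} → a ≤ r → peel f a r ≡ pred (f (suc r))
peel-≥ f {a} {r} a≤r with r <? a
... | yes r<a = ⊥-elim (<⇒≱ r<a a≤r)
... | no _    = refl

peel-shape : ∀ {m f} → Shape (suc m) f → ∀ {a} → 1 ≤ a → a ≤ suc m → Shape m (peel f a)
peel-shape {m} {f} S {a} 1≤a a≤ = record
  { row-zero = trans (peel-< f 1≤a) row-zero ; antitone = peel-antitone ; vanishes = peel-vanishes }
  where
  open Shape S
  peel-antitone : Antitone⁺ (peel f a)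
  peel-antitone {r} {r′} 1≤r r≤r′ = by-cases (r <? a) (r′ <? a)
    where
    by-cases : Dec (r < a) → Dec (r′ < a) → peel f a r′ ≤ peel f a r
    by-cases (yes r<a) (yes r′<a) = subst₂ _≤_ (sym (peel-< f r′<a)) (sym (peel-< f r<a)) (antitone 1≤r r≤r′)
    by-cases (yes r<a) (no r′≮a)  = subst₂ _≤_ (sym (peel-≥ f (≮⇒≥ r′≮a))) (sym (peel-< f r<a))
                                      (≤-trans pred[n]≤n (antitone 1≤r (≤-trans r≤r′ (n≤1+n r′))))
    by-cases (no r≮a)  (yes r′<a) = ⊥-elim (r≮a (≤-<-trans r≤r′ r′<a))
    by-cases (no r≮a)  (no r′≮a)  = subst₂ _≤_ (sym (peel-≥ f (≮⇒≥ r′≮a))) (sym (peel-≥ f (≮⇒≥ r≮a)))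
                                      (pred-mono-≤ (antitone (s≤s z≤n) (s≤s r≤r′)))
  peel-vanishes : ∀ r → m < r → peel f a r ≡ 0
  peel-vanishes r m<r = trans (peel-≥ f (≤-trans a≤ m<r)) (cong pred (vanishes (suc r) (s≤s m<r)))

peel-≤ : ∀ {ℓ f} → Shape ℓ f → ∀ {a} → 1 ≤ a → ∀ r → peel f a r ≤ f r
peel-≤ {f = f} S {a} 1≤a r = by-cases (r <? a)
  where
  by-cases : Dec (r < a) → peel f a r ≤ f r
  by-cases (yes r<a) = ≤-reflexive (peel-< f r<a)
  by-cases (no r≮a)  = subst (_≤ f r) (sym (peel-≥ f (≮⇒≥ r≮a)))
                         (≤-trans pred[n]≤n (Shape.antitone S (≤-trans 1≤a (≮⇒≥ r≮a)) (n≤1+n r)))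

drop-empty-row : ∀ {m f} → Shape (suc m) f → f (suc m) ≡ 0 → Shape m f
drop-empty-row {m} {f} S empty = record { row-zero = row-zero ; antitone = antitone ; vanishes = vanishes′ }
  where
  open Shape S
  vanishes′ : ∀ r → m < r → f r ≡ 0
  vanishes′ r m<r with m≤n⇒m<n∨m≡n m<r
  ... | inj₁ m+1<r = vanishes r m+1<r
  ... | inj₂ refl  = empty

firstRows : (ℕ → ℕ) → ℕ → List ℕ
firstRows f zero    = []
firstRows f (suc k) = f 1 ∷ firstRows (f ∘ suc) k

length-firstRows : ∀ f k → length (firstRows f k) ≡ k
length-firstRows f zero    = refl
length-firstRows f (suc k) = cong suc (length-firstRows (f ∘ suc) k)

rowLen-firstRows : ∀ f k {r} → 1 ≤ r → r ≤ k → rowLen (firstRows f k) r ≡ f r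
rowLen-firstRows f (suc k) {suc zero}    _ _          = refl
rowLen-firstRows f (suc k) {suc (suc r)} _ (s≤s r<k) = rowLen-firstRows (f ∘ suc) k (s≤s z≤n) r<k

firstRows-positive : ∀ f k → (∀ {r} → 1 ≤ r → r ≤ k → 1 ≤ f r) → All (0 <_) (firstRows f k)
firstRows-positive f zero    _   = []
firstRows-positive f (suc k) pos =
  pos ≤-refl (s≤s z≤n) ∷ firstRows-positive (f ∘ suc) k (λ _ r≤k → pos (s≤s z≤n) (s≤s r≤k))

firstRows-linked : ∀ f k → Antitone⁺ f → Linked (λ a b → b ≤ a) (firstRows f k)
firstRows-linked f zero          _        = []
firstRows-linked f (suc zero)    _        = [-]
firstRows-linked f (suc (suc k)) antitone =
  antitone ≤-refl (n≤1+n 1) ∷ firstRows-linked (f ∘ suc) (suc k) (λ _ r≤r′ → antitone (s≤s z≤n) (s≤s r≤r′))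

shape-partition : ∀ ℓ {f} → Shape ℓ f → Σ (List ℕ) λ μ → IsPartition μ × (∀ r → rowLen μ r ≡ f r)
shape-partition zero S = [] , ([] , []) , λ where
  zero    → sym (Shape.row-zero S)
  (suc r) → sym (Shape.vanishes S (suc r) (s≤s z≤n))
shape-partition (suc m) {f} S with 1 ≤? f (suc m)
... | no f≱1  = shape-partition m (drop-empty-row S (n≤0⇒n≡0 (≤-pred (≰⇒> f≱1))))
... | yes f≥1 = firstRows f (suc m) , (positive , firstRows-linked f (suc m) antitone) , rowLen-firstRows-≡
  where
  open Shape S
  positive : All (0 <_) (firstRows f (suc m))
  positive = firstRows-positive f (suc m) (λ 1≤r r≤ → ≤-trans f≥1 (antitone 1≤r r≤))
  rowLen-firstRows-≡ : ∀ r → rowLen (firstRows f (suc m)) r ≡ f r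
  rowLen-firstRows-≡ zero = trans (rowLen-zero (firstRows f (suc m))) (sym row-zero)
  rowLen-firstRows-≡ (suc r) with suc r ≤? suc m
  ... | yes r<ℓ = rowLen-firstRows f (suc m) (s≤s z≤n) r<ℓ
  ... | no r≮ℓ  =
    trans (rowLen-beyond (firstRows f (suc m)) (suc r) (subst (_< suc r) (sym (length-firstRows f (suc m))) (≰⇒> r≮ℓ)))
          (sym (vanishes (suc r) (≰⇒> r≮ℓ)))

module OuterRimDecomposition {m : ℕ} {f : ℕ → ℕ} (S : Shape (suc m) f) (last-nonempty : 1 ≤ f (suc m))
                             (a : ℕ) (1≤a : 1 ≤ a) (a≤ℓ : a ≤ suc m) where
  open Shape S
  open ShapeGeometry S
  open RimWalk last-nonempty
  open OuterRim a 1≤a a≤ℓ public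

  OnOuterRim : Cell → Set
  OnOuterRim e = OnRim f e × a ≤ row e

  inPeel⇒ : ∀ {e} → InShape (peel f a) e → InShape f e × ¬ OnOuterRim e
  inPeel⇒ {p , q} (1≤q , q≤) = by-cases (p <? a)
    where
    by-cases : Dec (p < a) → InShape f (p , q) × ¬ OnOuterRim (p , q)
    by-cases (yes p<a) = (1≤q , subst (q ≤_) (peel-< f p<a) q≤) , λ (_ , a≤p) → <⇒≱ p<a a≤p
    by-cases (no p≮a)  = (1≤q , ≤-trans (n≤1+n q) (≤-trans q<f (antitone (≤-trans 1≤a (≮⇒≥ p≮a)) (n≤1+n p))))
                       , λ (rim , _) → <⇒≱ q<f rim
      where
      q<f : suc q ≤ f (suc p)
      q<f with f (suc p) | subst (q ≤_) (peel-≥ f (≮⇒≥ p≮a)) q≤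
      ... | zero    | q≤0 = ⊥-elim (<⇒≱ 1≤q q≤0)
      ... | suc fp  | q≤fp = s≤s q≤fp

  inPeel⇐ : ∀ {e} → InShape f e → ¬ OnOuterRim e → InShape (peel f a) e
  inPeel⇐ {p , q} (1≤q , q≤) off-rim = by-cases (p <? a)
    where
    by-cases : Dec (p < a) → InShape (peel f a) (p , q)
    by-cases (yes p<a) = 1≤q , subst (q ≤_) (sym (peel-< f p<a)) q≤
    by-cases (no p≮a)  = 1≤q , subst (q ≤_) (sym (peel-≥ f (≮⇒≥ p≮a)))
                                 (<⇒≤pred (≰⇒> (λ rim → off-rim (rim , ≮⇒≥ p≮a))))

  outerRim-or-peel : ∀ {e} → InShape f e → e ∈ outerRim ⊎ InShape (peel f a) e
  outerRim-or-peel {e} e-in with f (suc (row e)) ≤? col e | a ≤? row e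
  ... | yes rim | yes a≤e = inj₁ (outerRim-complete e-in rim a≤e)
  ... | no off  | _       = inj₂ (inPeel⇐ e-in (off ∘ proj₁))
  ... | _       | no a≰e  = inj₂ (inPeel⇐ e-in (a≰e ∘ proj₂))

  peel-∉-outerRim : ∀ {e} → InShape (peel f a) e → e ∈ outerRim → ⊥
  peel-∉-outerRim e-in e∈ = let (_ , rim , a≤e) = outerRim-sound e∈ in proj₂ (inPeel⇒ e-in) (rim , a≤e)

  outerRim-rimHook : IsRimHook outerRim
  outerRim-rimHook = outerRim-unique , (_ , outerRim-first) , skew , outerRim-connected , outerRim-no2x2
    where
    outer : Σ (List ℕ) λ μ → IsPartition μ × (∀ r → rowLen μ r ≡ f r)
    outer = shape-partition (suc m) S
    inner : Σ (List ℕ) λ ν → IsPartition ν × (∀ r → rowLen ν r ≡ peel f a r)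
    inner = shape-partition m (peel-shape S 1≤a a≤ℓ)
    module μ {c} = Equivalence (diagram-of (proj₁ outer) (proj₂ (proj₂ outer)) {c})
    module ν {c} = Equivalence (diagram-of (proj₁ inner) (proj₂ (proj₂ inner)) {c})
    skew : IsSkew outerRim
    skew = proj₁ outer , proj₁ inner , proj₁ (proj₂ outer) , proj₁ (proj₂ inner)
         , (λ (i , j) d → let (1≤j , j≤) = ν.to d in μ.from (1≤j , ≤-trans j≤ (peel-≤ S 1≤a i)))
         , λ c → mk⇔ (λ c∈ → μ.from (proj₁ (outerRim-sound c∈)) , λ d → peel-∉-outerRim (ν.to d) c∈)
                     (λ (d , ¬d′) → [ (λ c∈ → c∈) , (λ d′ → ⊥-elim (¬d′ (ν.from d′))) ]′ (outerRim-or-peel (μ.to d)))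

Disjoint : List Cell → List Cell → Set
Disjoint H H′ = ∀ c → c ∈ H → c ∈ H′ → ⊥

allPairs-∈ : ∀ {A : Set} {R : A → A → Set} {xs x y} → AllPairs R xs → x ∈ xs → y ∈ xs → x ≡ y ⊎ R x y ⊎ R y x
allPairs-∈ (_ ∷ _)      (here refl) (here refl) = inj₁ refl
allPairs-∈ (Rx ∷ _)     (here refl) (there y∈)  = inj₂ (inj₁ (All.lookup Rx y∈))
allPairs-∈ (Ry ∷ _)     (there x∈)  (here refl) = inj₂ (inj₂ (All.lookup Ry x∈))
allPairs-∈ (_ ∷ pairs)  (there x∈)  (there y∈)  = allPairs-∈ pairs x∈ y∈

-- An SRT over an arbitrary shape, with hooks addressed by membership rather than by position.
record Tableau (f : ℕ → ℕ) : Set where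
  constructor mkTableau
  field
    hookList         : List (List Cell)
    allRimHooks      : All IsRimHook hookList
    allSpecial       : All MeetsFirstColumn hookList
    allInside        : All (λ H → ∀ c → c ∈ H → InShape f c) hookList
    covering         : ∀ c → InShape f c → Σ (List Cell) λ H → H ∈ hookList × c ∈ H
    pairwiseDisjoint : AllPairs Disjoint hookList

  same-hook : ∀ {H H′ c} → H ∈ hookList → H′ ∈ hookList → c ∈ H → c ∈ H′ → H ≡ H′
  same-hook H∈ H′∈ c∈H c∈H′ with allPairs-∈ pairwiseDisjoint H∈ H′∈
  ... | inj₁ H≡H′        = H≡H′
  ... | inj₂ (inj₁ disj) = ⊥-elim (disj _ c∈H c∈H′)
  ... | inj₂ (inj₂ disj) = ⊥-elim (disj _ c∈H′ c∈H)

  terminal-col : ∀ {H t} → H ∈ hookList → IsTerminal H t → col t ≡ 1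
  terminal-col H∈ (t∈ , t≤) =
    let (_ , r1∈) = All.lookup allSpecial H∈ in ≤-antisym (proj₂ (t≤ _ r1∈)) (proj₁ (All.lookup allInside H∈ _ t∈))

  hook-through : ∀ {c} → InShape f c → Σ (List Cell) λ H → H ∈ hookList × c ∈ H × Σ ℕ λ r → (r , 1) ∈ H × row c ≤ r
  hook-through {c} c-in with covering c c-in
  ... | H , H∈ , c∈ with RimHook.terminal-exists (All.lookup allRimHooks H∈)
  ... | t , t∈ , t≥ with terminal-col H∈ (t∈ , t≥)
  ... | refl = H , H∈ , c∈ , row t , t∈ , proj₁ (t≥ c c∈)

module SideBySide {H H′ : List Cell} (rh : IsRimHook H) (rh′ : IsRimHook H′) (H-H′-disjoint : Disjoint H H′) where
  private
    module H  = RimHook rh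
    module H′ = RimHook rh′

  east-step : ∀ {p q p′ q′} → p ∈ H → q ∈ H′ → p′ ∈ H → q′ ∈ H′ →
              NextDiagonal p p′ → NextDiagonal q q′ → SameDiagonal p q → col p < col q → col p′ < col q′
  east-step {p} {q} {p′} {q′} p∈ q∈ p′∈ q′∈ pp′ qq′ pq p<q = ≤∧≢⇒< p′≤q′ λ same-col →
    H-H′-disjoint _ p′∈
      (subst (_∈ H′) (sym (same-diagonal-col (next-diagonal-same {p} {q} {p′} {q′} pq pp′ qq′) same-col)) q′∈)
    where
    p′≤p : col p′ ≤ col p
    p′≤p with H.next-diagonal p∈ p′∈ pp′
    ... | inj₁ (_ , same) = ≤-reflexive same
    ... | inj₂ (_ , left) = ≤-trans (n≤1+n _) (≤-reflexive (sym left))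
    q≤q′+1 : col q ≤ suc (col q′)
    q≤q′+1 with H′.next-diagonal q∈ q′∈ qq′
    ... | inj₁ (_ , same) = ≤-trans (≤-reflexive (sym same)) (n≤1+n _)
    ... | inj₂ (_ , left) = ≤-reflexive left
    p′≤q′ : col p′ ≤ col q′
    p′≤q′ = ≤-pred (≤-trans (s≤s p′≤p) (≤-trans p<q q≤q′+1))

  -- Once H′ lies east of H on some diagonal it stays so, diagonal by diagonal, hence H
  -- cannot reach the diagonal on which H′ meets the first column.
  east-blocks-first-column : ∀ {p q r e} → p ∈ H → q ∈ H′ → SameDiagonal p q → col p < col q →
                             (r , 1) ∈ H′ → q ≼ (r , 1) → e ∈ H → (r , 1) ≼ e → ⊥
  east-blocks-first-column {r = r} {e} p∈ q∈ pq p<q r1∈ q≼r1 e∈ r1≼e =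
    go (proj₁ (≼⇒diagonals-after q≼r1)) p∈ q∈ pq p<q (proj₂ (≼⇒diagonals-after q≼r1))
    where
    go : ∀ d {p q} → p ∈ H → q ∈ H′ → SameDiagonal p q → col p < col q → DiagonalsAfter q d (r , 1) → ⊥
    go zero {q = q} p∈ q∈ _ p<q gap with H′.diagonal-injective q∈ r1∈ (diagonals-after-zero {q} {r , 1} gap)
    ... | refl = <⇒≱ p<q (H.col-pos p∈)
    go (suc d) {p} {q} p∈ q∈ pq p<q gap =
      let (q′ , q′∈ , qq′) = H′.meets-diagonals q∈ r1∈ (mk≼ (n≤1+n _)) zq≼r1
          (p′ , p′∈ , pp′) = H.meets-diagonals p∈ e∈ (mk≼ (n≤1+n _)) (≼-trans zp≼zq (≼-trans zq≼r1 r1≼e))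
      in go d p′∈ q′∈ (next-diagonal-same {p} {q} {p′} {q′} pq pp′ qq′) (east-step p∈ q∈ p′∈ q′∈ pp′ qq′ pq p<q)
            (diagonals-after-next {q} {q′} {r , 1} gap qq′)
      where
      zp≼zq : (suc (row p) , col p) ≼ (suc (row q) , col q)
      zp≼zq = mk≼ (≤-reflexive (cong suc pq))
      zq≼r1 : (suc (row q) , col q) ≼ (r , 1)
      zq≼r1 = mk≼ (≤-trans (+-monoˡ-≤ 1 (≤-trans (s≤s (m≤m+n _ d)) (≤-reflexive (sym (+-suc _ d))))) (≤-reflexive gap))

module LastHook {m : ℕ} {f : ℕ → ℕ} (S : Shape (suc m) f) (last-nonempty : 1 ≤ f (suc m)) (T : Tableau f) where
  open Shape S
  open ShapeGeometry S
  open Tableau T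

  private
    corner-hook = covering (suc m , 1) (≤-refl , last-nonempty)

  H₀ : List Cell
  H₀ = proj₁ corner-hook

  H₀∈ : H₀ ∈ hookList
  H₀∈ = proj₁ (proj₂ corner-hook)

  corner∈H₀ : (suc m , 1) ∈ H₀
  corner∈H₀ = proj₂ (proj₂ corner-hook)

  private
    module H₀ = RimHook (All.lookup allRimHooks H₀∈)

    H₀-inside : ∀ c → c ∈ H₀ → InShape f c
    H₀-inside = All.lookup allInside H₀∈

  -- If the cell south-east of (a , b) ∈ H₀ were in the shape, its hook would lie east of H₀
  -- on the diagonal of (a , b) and reach the first column before H₀ does.
  last-hook-on-rim : ∀ {c} → c ∈ H₀ → OnRim f c
  last-hook-on-rim {a , b} ab∈ with suc b ≤? f (suc a)
  ... | no  off = ≤-pred (≰⇒> off)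
  ... | yes q₀-in with hook-through {suc a , suc b} (s≤s z≤n , q₀-in)
  ... | H′ , H′∈ , q₀∈ , r , r1∈ , a<r =
    ⊥-elim (SideBySide.east-blocks-first-column (All.lookup allRimHooks H₀∈) (All.lookup allRimHooks H′∈) H₀-H′-disjoint
              ab∈ q₀∈ (+-suc a b) ≤-refl r1∈ (mk≼ (+-mono-≤ a<r (s≤s z≤n))) corner∈H₀ (mk≼ (+-monoˡ-≤ 1 r≤ℓ)))
    where
    r≤ℓ : r ≤ suc m
    r≤ℓ = proj₂ (inShape-rows (All.lookup allInside H′∈ _ r1∈))
    H₀-H′-disjoint : Disjoint H₀ H′
    H₀-H′-disjoint c c∈H₀ c∈H′ with same-hook H₀∈ H′∈ c∈H₀ c∈H′
    ... | refl = H₀.no-south-east-pair ab∈ q₀∈ ≤-refl ≤-refl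

  -- If (a₀ , b₀ + 1) were in the shape, its hook would have to pass through (a₀ , b₀) or
  -- through the cell below (a₀ , b₀ + 1), which is outside the shape since (a₀ , b₀) is on the rim.
  initial-at-row-end : ∀ {a₀ b₀} → IsInitial H₀ (a₀ , b₀) → b₀ ≡ f a₀
  initial-at-row-end {a₀} {b₀} (ab∈ , ab≤) = ≤-antisym (proj₂ (H₀-inside _ ab∈)) (≮⇒≥ beyond-outside)
    where
    beyond-outside : b₀ < f a₀ → ⊥
    beyond-outside b₀< with hook-through {a₀ , suc b₀} (s≤s z≤n , b₀<)
    ... | H′ , H′∈ , q₀∈ , r , r1∈ , a₀≤r
      with RimHook.meets-diagonals (All.lookup allRimHooks H′∈) q₀∈ r1∈ (mk≼ (+-monoʳ-≤ a₀ (n≤1+n b₀)))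
                                   (mk≼ (+-mono-≤ a₀≤r (H₀.col-pos ab∈)))
    ... | q , q∈ , q≡ab
      with RimHook.next-diagonal (All.lookup allRimHooks H′∈) q₀∈ q∈ (trans (+-suc (row q) b₀) (cong suc q≡ab))
    ... | inj₁ (refl , refl) = <⇒≱ (proj₂ (All.lookup allInside H′∈ _ q∈)) (last-hook-on-rim ab∈)
    ... | inj₂ (refl , b₀≡) with same-hook H₀∈ H′∈ ab∈ (subst (λ b → (a₀ , b) ∈ H′) (sym (suc-injective b₀≡)) q∈)
    ... | refl = <-irrefl refl (proj₂ (ab≤ _ q₀∈))

  private
    initial₀ = H₀.initial-exists

  a₀ : ℕ
  a₀ = proj₁ (proj₁ initial₀)

  1≤a₀ : 1 ≤ a₀
  1≤a₀ = H₀.row-pos (proj₁ (proj₂ initial₀))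

  a₀≤ℓ : a₀ ≤ suc m
  a₀≤ℓ = proj₂ (inShape-rows (H₀-inside _ (proj₁ (proj₂ initial₀))))

  last-hook-initial : IsInitial H₀ (a₀ , f a₀)
  last-hook-initial = subst (λ b → IsInitial H₀ (a₀ , b)) (initial-at-row-end (proj₂ initial₀)) (proj₂ initial₀)

  open OuterRimDecomposition S last-nonempty a₀ 1≤a₀ a₀≤ℓ

  last-hook⊆outerRim : ∀ {c} → c ∈ H₀ → c ∈ outerRim
  last-hook⊆outerRim c∈ = outerRim-complete (H₀-inside _ c∈) (last-hook-on-rim c∈) (proj₁ (proj₂ last-hook-initial _ c∈))

  outerRim⊆last-hook : ∀ {c} → c ∈ outerRim → c ∈ H₀
  outerRim⊆last-hook {c} c∈ =
    let (c-in , c-rim , a₀≤c) = outerRim-sound c∈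
        (p , p∈ , same) = H₀.meets-diagonals (proj₁ last-hook-initial) corner∈H₀
                            (mk≼ (+-mono-≤ a₀≤c (≤-trans (proj₂ c-in) (antitone 1≤a₀ a₀≤c))))
                            (mk≼ (+-mono-≤ (proj₂ (inShape-rows c-in)) (proj₁ c-in)))
    in subst (_∈ H₀) (rim-diagonal-injective (H₀-inside _ p∈) (last-hook-on-rim p∈) c-in c-rim same) p∈

  last-hook-cells : ∀ {c} → c ∈ H₀ ⇔ (InShape f c × OnRim f c × a₀ ≤ row c)
  last-hook-cells = mk⇔ (outerRim-sound ∘ last-hook⊆outerRim)
                        (λ (c-in , c-rim , a₀≤c) → outerRim⊆last-hook (outerRim-complete c-in c-rim a₀≤c))

  length-last-hook : length H₀ + a₀ ≡ f a₀ + suc m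
  length-last-hook = trans (cong (_+ a₀) same-length) length-outerRim
    where
    same-length : length H₀ ≡ length outerRim
    same-length = ↭-length (∼bag⇒↭ (unique∧set⇒bag (proj₁ (All.lookup allRimHooks H₀∈)) outerRim-unique
                                                    (mk⇔ last-hook⊆outerRim outerRim⊆last-hook)))

  last-hook-terminal : IsTerminal H₀ (suc m , 1)
  last-hook-terminal = corner∈H₀ , λ e e∈ → proj₂ (inShape-rows (H₀-inside e e∈)) , proj₁ (H₀-inside e e∈)

  private
    avoids-corner? : (H : List Cell) → Dec (¬ (suc m , 1) ∈ H)
    avoids-corner? H = ¬? ((suc m , 1) ∈? H)

  otherHooks : List (List Cell)
  otherHooks = filter avoids-corner? hookList

  hook-cases : ∀ {H} → H ∈ hookList → H ≡ H₀ ⊎ H ∈ otherHooks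
  hook-cases {H} H∈ with (suc m , 1) ∈? H
  ... | yes corner∈ = inj₁ (same-hook H∈ H₀∈ corner∈ corner∈H₀)
  ... | no  corner∉ = inj₂ (∈-filter⁺ avoids-corner? H∈ corner∉)

  otherHook : ∀ {H} → H ∈ otherHooks → H ∈ hookList × ¬ (suc m , 1) ∈ H
  otherHook = ∈-filter⁻ avoids-corner?

  peeled : Tableau (peel f a₀)
  peeled = mkTableau otherHooks (All.filter⁺ avoids-corner? allRimHooks) (All.filter⁺ avoids-corner? allSpecial)
                     (All.tabulate inside-peel) cover-peel (AllPairs.filter⁺ avoids-corner? pairwiseDisjoint)
    where
    inside-peel : ∀ {H} → H ∈ otherHooks → ∀ c → c ∈ H → InShape (peel f a₀) c
    inside-peel H∈ c c∈ =
      let (H∈′ , corner∉) = otherHook H∈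
          not-on-rim : c ∈ outerRim → InShape (peel f a₀) c
          not-on-rim c∈rim =
            ⊥-elim (corner∉ (subst ((suc m , 1) ∈_) (same-hook H₀∈ H∈′ (outerRim⊆last-hook c∈rim) c∈) corner∈H₀))
      in [ not-on-rim , (λ c-in → c-in) ]′ (outerRim-or-peel (All.lookup allInside H∈′ c c∈))
    cover-peel : ∀ c → InShape (peel f a₀) c → Σ (List Cell) λ H → H ∈ otherHooks × c ∈ H
    cover-peel c c-in with covering c (proj₁ (inPeel⇒ c-in))
    ... | H , H∈ , c∈ with hook-cases H∈
    ... | inj₂ H∈′ = H , H∈′ , c∈
    ... | inj₁ refl = ⊥-elim (peel-∉-outerRim c-in (last-hook⊆outerRim c∈))

toℕ-punchIn-< : ∀ {n} (i : Fin (suc n)) (j : Fin n) → toℕ j < toℕ i → toℕ (punchIn i j) ≡ toℕ j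
toℕ-punchIn-< (Fin.suc i) Fin.zero    _         = refl
toℕ-punchIn-< (Fin.suc i) (Fin.suc j) (s≤s j<i) = cong suc (toℕ-punchIn-< i j j<i)

toℕ-punchIn-≥ : ∀ {n} (i : Fin (suc n)) (j : Fin n) → toℕ i ≤ toℕ j → toℕ (punchIn i j) ≡ suc (toℕ j)
toℕ-punchIn-≥ Fin.zero    j           _         = refl
toℕ-punchIn-≥ (Fin.suc i) (Fin.suc j) (s≤s i≤j) = cong suc (toℕ-punchIn-≥ i j i≤j)

rowOf-injective : ∀ {n} {i j : Fin n} → rowOf i ≡ rowOf j → i ≡ j
rowOf-injective = toℕ-injective ∘ suc-injective

rowOf-fromℕ : ∀ m → rowOf (fromℕ m) ≡ suc m
rowOf-fromℕ m = cong suc (toℕ-fromℕ m)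

rowOf-punchIn-fromℕ : ∀ m (j : Fin m) → rowOf (punchIn (fromℕ m) j) ≡ rowOf j
rowOf-punchIn-fromℕ m j = cong suc (toℕ-punchIn-< (fromℕ m) j (subst (toℕ j <_) (sym (toℕ-fromℕ m)) (toℕ<n j)))

record LastAt {m} (i : Fin (suc m)) (σ : Permutation′ (suc m)) (σ′ : Permutation′ m) : Set where
  constructor lastAt
  field
    at-i      : σ ⟨$⟩ʳ i ≡ fromℕ m
    elsewhere : ∀ j → σ ⟨$⟩ʳ punchIn i j ≡ punchIn (fromℕ m) (σ′ ⟨$⟩ʳ j)

  row-at-i : rowOf (σ ⟨$⟩ʳ i) ≡ suc m
  row-at-i = trans (cong rowOf at-i) (rowOf-fromℕ m)

  row-elsewhere : ∀ j → rowOf (σ ⟨$⟩ʳ punchIn i j) ≡ rowOf (σ′ ⟨$⟩ʳ j)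
  row-elsewhere j = trans (cong rowOf (elsewhere j)) (rowOf-punchIn-fromℕ m _)

remove-lastAt : ∀ {m} i (σ : Permutation′ (suc m)) → σ ⟨$⟩ʳ i ≡ fromℕ m → LastAt i σ (remove i σ)
remove-lastAt i σ σi≡ =
  lastAt σi≡ λ j → trans (punchIn-permute σ i j) (cong (λ x → punchIn x (remove i σ ⟨$⟩ʳ j)) σi≡)

insert-lastAt : ∀ {m} i (σ′ : Permutation′ m) → LastAt i (insert i (fromℕ m) σ′) σ′
insert-lastAt {m} i σ′ = lastAt insert-self (insert-punchIn i (fromℕ m) σ′)
  where
  insert-self : insert i (fromℕ m) σ′ ⟨$⟩ʳ i ≡ fromℕ m
  insert-self with i Fin.≟ i
  ... | yes _ = refl
  ... | no i≢i = ⊥-elim (i≢i refl)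

rowEnd : (ℕ → ℕ) → ℕ → Cell
rowEnd f r = r , f r

rowEnd-diagonal-injective : ∀ {f} → Antitone⁺ f → ∀ {r r′} → 1 ≤ r → 1 ≤ r′ →
                            SameDiagonal (rowEnd f r) (rowEnd f r′) → r ≡ r′
rowEnd-diagonal-injective {f} antitone {r} {r′} 1≤r 1≤r′ same with <-cmp r r′
... | tri≈ _ r≡r′ _ = r≡r′
... | tri< r<r′ _ _ = ⊥-elim (<-irrefl same (+-mono-<-≤ r<r′ (antitone 1≤r (<⇒≤ r<r′))))
... | tri> _ _ r′<r = ⊥-elim (<-irrefl (sym same) (+-mono-<-≤ r′<r (antitone 1≤r′ (<⇒≤ r′<r))))

StartsOn : List Cell → Cell → Set
StartsOn H e = Σ Cell λ c → IsInitial H c × SameDiagonal c e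

SomeStartsOn : List (List Cell) → Cell → Set
SomeStartsOn hs e = Σ (List Cell) λ H → H ∈ hs × StartsOn H e

-- Everything is measured along the diagonal of the row end e = (r , f r): the hook starting
-- on it has length f r − r + σ r, i.e. (σ r , length) lies on that diagonal, and if no hook
-- starts on it then σ r = r − f r, i.e. (σ r , 0) lies on it.
record HookFitsAt (f : ℕ → ℕ) {ℓ} (σ : Permutation′ ℓ) (i : Fin ℓ) (H : List Cell) : Set where
  constructor hookFits
  field
    starts-on          : StartsOn H (rowEnd f (rowOf i))
    ends-in-row        : Σ Cell λ t → IsTerminal H t × row t ≡ rowOf (σ ⟨$⟩ʳ i)
    length-on-diagonal : SameDiagonal (rowEnd f (rowOf i)) (rowOf (σ ⟨$⟩ʳ i) , length H)

RowFits : List (List Cell) → (ℕ → ℕ) → ∀ {ℓ} → Permutation′ ℓ → Fin ℓ → Set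
RowFits hs f σ i =
  (¬ SomeStartsOn hs (rowEnd f (rowOf i)) × SameDiagonal (rowEnd f (rowOf i)) (rowOf (σ ⟨$⟩ʳ i) , 0))
  ⊎ SomeStartsOn hs (rowEnd f (rowOf i))

PermOf : List (List Cell) → (ℕ → ℕ) → ∀ {ℓ} → Permutation′ ℓ → Set
PermOf hs f {ℓ} σ = (∀ {H} → H ∈ hs → Σ (Fin ℓ) λ i → HookFitsAt f σ i H) × (∀ i → RowFits hs f σ i)

startsOn-transfer : ∀ {H e e′} → SameDiagonal e e′ → StartsOn H e → StartsOn H e′
startsOn-transfer {e = e} {e′} e~e′ (c , init , c~e) = c , init , same-diagonal-trans {c} {e} {e′} c~e e~e′

hookFitsAt-transfer : ∀ {f f′ ℓ ℓ′} {σ : Permutation′ ℓ} {σ′ : Permutation′ ℓ′} {i j H} →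
  rowOf (σ ⟨$⟩ʳ i) ≡ rowOf (σ′ ⟨$⟩ʳ j) → SameDiagonal (rowEnd f (rowOf i)) (rowEnd f′ (rowOf j)) →
  HookFitsAt f σ i H → HookFitsAt f′ σ′ j H
hookFitsAt-transfer {f} {f′} {i = i} {j} {H} σi≡ e~e′ (hookFits start (t , term , row-t) length-diag) =
  hookFits (startsOn-transfer {e = rowEnd f (rowOf i)} e~e′ start) (t , term , trans row-t σi≡)
    (same-diagonal-trans {rowEnd f′ (rowOf j)} {rowEnd f (rowOf i)} (sym e~e′)
      (subst (λ s → SameDiagonal (rowEnd f (rowOf i)) (s , length H)) σi≡ length-diag))

permOf-cong : ∀ {hs f ℓ} {σ τ : Permutation′ ℓ} → (∀ i → σ ⟨$⟩ʳ i ≡ τ ⟨$⟩ʳ i) → PermOf hs f σ → PermOf hs f τ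
permOf-cong {f = f} {σ = σ} {τ} σ≗τ (hooks-fit , rows-fit) = hooks-fit′ , rows-fit′
  where
  hooks-fit′ : ∀ {H} → _ → Σ _ λ i → HookFitsAt f τ i H
  hooks-fit′ {H} H∈ =
    let (i , hookFits start (t , term , row-t) length-diag) = hooks-fit H∈
    in i , hookFits start (t , term , trans row-t (cong rowOf (σ≗τ i)))
                    (subst (λ s → SameDiagonal (rowEnd f (rowOf i)) (rowOf s , length H)) (σ≗τ i) length-diag)
  rows-fit′ : ∀ i → RowFits _ f τ i
  rows-fit′ i with rows-fit i
  ... | inj₁ (none , s-diag) =
    inj₁ (none , subst (λ s → SameDiagonal (rowEnd f (rowOf i)) (rowOf s , 0)) (σ≗τ i) s-diag)
  ... | inj₂ some = inj₂ some

fits-at : ∀ {f} → Antitone⁺ f → ∀ {hs ℓ} {σ : Permutation′ ℓ} {H i} →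
          PermOf hs f σ → H ∈ hs → StartsOn H (rowEnd f (rowOf i)) → HookFitsAt f σ i H
fits-at {f} antitone {σ = σ} {H} {i} (hooks-fit , _) H∈ (c , init , c~) =
  let (j , fits) = hooks-fit H∈
      (c′ , init′ , c′~) = HookFitsAt.starts-on fits
      c~j : SameDiagonal c (rowEnd f (rowOf j))
      c~j = subst (λ x → SameDiagonal x (rowEnd f (rowOf j))) (initial-unique init′ init) c′~
      j≡i = rowOf-injective (rowEnd-diagonal-injective antitone (s≤s z≤n) (s≤s z≤n)
                               (same-diagonal-trans {rowEnd f (rowOf j)} {c} (sym c~j) c~))
  in subst (λ k → HookFitsAt f σ k H) j≡i fits

-- Relating perm_SRT of a tableau to that of the tableau left after removing the hooks
-- `extra`, all starting on the diagonal of the row end of i₀, where σ i₀ is the last row.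
module Restriction {m : ℕ} {f f′ : ℕ → ℕ} (f-antitone : Antitone⁺ f)
  {hs hs₀ extra : List (List Cell)}
  (split : ∀ {H} → H ∈ hs → H ∈ extra ⊎ H ∈ hs₀) (rest-⊆ : ∀ {H} → H ∈ hs₀ → H ∈ hs)
  (i₀ : Fin (suc m)) (extra-start : ∀ {H} → H ∈ extra → StartsOn H (rowEnd f (rowOf i₀)))
  (shift : ∀ j → SameDiagonal (rowEnd f (rowOf (punchIn i₀ j))) (rowEnd f′ (rowOf j)))
  {σ : Permutation′ (suc m)} {σ′ : Permutation′ m} (σ-lastAt : LastAt i₀ σ σ′) where

  private
    e : Fin m → Cell
    e j = rowEnd f (rowOf (punchIn i₀ j))

    e′ : Fin m → Cell
    e′ j = rowEnd f′ (rowOf j)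

    extra-elsewhere : ∀ {H} j → H ∈ extra → StartsOn H (e j) → ⊥
    extra-elsewhere {H} j H∈ (c , init , c~) with extra-start H∈
    ... | c′ , init′ , c′~ rewrite initial-unique init init′ =
      punchInᵢ≢i i₀ j (rowOf-injective (rowEnd-diagonal-injective f-antitone (s≤s z≤n) (s≤s z≤n)
        (same-diagonal-trans {e j} {c′} (sym c~) c′~)))

    starts⇒ : ∀ j → SomeStartsOn hs (e j) → SomeStartsOn hs₀ (e′ j)
    starts⇒ j (H , H∈ , start) with split H∈
    ... | inj₁ H∈extra = ⊥-elim (extra-elsewhere j H∈extra start)
    ... | inj₂ H∈rest  = H , H∈rest , startsOn-transfer {e = e j} (shift j) start

    starts⇐ : ∀ j → SomeStartsOn hs₀ (e′ j) → SomeStartsOn hs (e j)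
    starts⇐ j (H , H∈ , start) = H , rest-⊆ H∈ , startsOn-transfer {e = e′ j} (sym (shift j)) start

    σ-row : ∀ j → rowOf (σ ⟨$⟩ʳ punchIn i₀ j) ≡ rowOf (σ′ ⟨$⟩ʳ j)
    σ-row = LastAt.row-elsewhere σ-lastAt

  rowFits⇒ : ∀ j → RowFits hs f σ (punchIn i₀ j) → RowFits hs₀ f′ σ′ j
  rowFits⇒ j (inj₁ (none , s-diag)) =
    inj₁ ( none ∘ starts⇐ j
         , same-diagonal-trans {e′ j} {e j} (sym (shift j)) (subst (λ s → SameDiagonal (e j) (s , 0)) (σ-row j) s-diag))
  rowFits⇒ j (inj₂ some) = inj₂ (starts⇒ j some)

  rowFits⇐ : ∀ j → RowFits hs₀ f′ σ′ j → RowFits hs f σ (punchIn i₀ j)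
  rowFits⇐ j (inj₁ (none , s-diag)) =
    inj₁ ( none ∘ starts⇒ j
         , same-diagonal-trans {e j} {e′ j} (shift j) (subst (λ s → SameDiagonal (e′ j) (s , 0)) (sym (σ-row j)) s-diag))
  rowFits⇐ j (inj₂ some) = inj₂ (starts⇐ j some)

  extend : PermOf hs₀ f′ σ′ → (∀ {H} → H ∈ extra → HookFitsAt f σ i₀ H) → RowFits hs f σ i₀ → PermOf hs f σ
  extend (hooks-fit , rows-fit) extra-fits row₀-fits = hooks-fit′ , rows-fit′
    where
    hooks-fit′ : ∀ {H} → H ∈ hs → Σ (Fin (suc m)) λ i → HookFitsAt f σ i H
    hooks-fit′ H∈ with split H∈
    ... | inj₁ H∈extra = i₀ , extra-fits H∈extra
    ... | inj₂ H∈rest  = let (j , fits) = hooks-fit H∈rest in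
      punchIn i₀ j , hookFitsAt-transfer {f′} {f} {σ = σ′} {σ} (sym (σ-row j)) (sym (shift j)) fits
    rows-fit′ : ∀ i → RowFits hs f σ i
    rows-fit′ i with i₀ Fin.≟ i
    ... | yes refl = row₀-fits
    ... | no i₀≢i  = subst (RowFits hs f σ) (punchIn-punchOut i₀≢i) (rowFits⇐ _ (rows-fit (punchOut i₀≢i)))

  restrict : (∀ {H} → H ∈ hs₀ → ¬ (suc m , 1) ∈ H) → (∀ {H t} → H ∈ hs₀ → IsTerminal H t → col t ≡ 1) →
             PermOf hs f σ → PermOf hs₀ f′ σ′
  restrict corner-free terminal-col (hooks-fit , rows-fit) = hooks-fit′ , λ j → rowFits⇒ j (rows-fit (punchIn i₀ j))
    where
    hooks-fit′ : ∀ {H} → H ∈ hs₀ → Σ (Fin m) λ j → HookFitsAt f′ σ′ j H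
    hooks-fit′ {H} H∈ with hooks-fit (rest-⊆ H∈)
    ... | i , fits@(hookFits _ (t , term , row-t) _) with i₀ Fin.≟ i
    ... | yes refl =
      ⊥-elim (corner-free H∈ (subst (_∈ H) (cong₂ _,_ (trans row-t (LastAt.row-at-i σ-lastAt)) (terminal-col H∈ term)) (proj₁ term)))
    ... | no i₀≢i  = j , hookFitsAt-transfer {f} {f′} {σ = σ} {σ′} (σ-row j) (shift j)
                          (subst (λ k → HookFitsAt f σ k H) (sym (punchIn-punchOut i₀≢i)) fits)
      where
      j = punchOut i₀≢i

empty-last-row-no-start : ∀ {m f} → Shape (suc m) f → f (suc m) ≡ 0 → ∀ {hs} →
  (∀ {H} → H ∈ hs → ∀ c → c ∈ H → InShape f c) → ¬ SomeStartsOn hs (rowEnd f (suc m))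
empty-last-row-no-start {m} S empty inside (H , H∈ , c , init , c~) =
  <⇒≱ (subst (suc m <_) (sym below) (m<m+n (suc m) (proj₁ c-in))) (proj₂ (ShapeGeometry.inShape-rows S c-in))
  where
  c-in = inside H∈ _ (proj₁ init)
  below : row c ≡ suc m + col c
  below = trans (sym (+-identityʳ (row c))) (trans (cong (λ x → row c + x) (sym empty)) c~)

same-shift : ∀ m f (j : Fin m) → SameDiagonal (rowEnd f (rowOf (punchIn (fromℕ m) j))) (rowEnd f (rowOf j))
same-shift m f j = subst (λ r → r + f (rowOf j) ≡ rowOf j + f r) (sym (rowOf-punchIn-fromℕ m j)) refl

peel-shift : ∀ {m f} → Shape (suc m) f → 1 ≤ f (suc m) → (i₀ : Fin (suc m)) → ∀ {a} → rowOf i₀ ≡ a →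
             ∀ j → SameDiagonal (rowEnd f (rowOf (punchIn i₀ j))) (rowEnd (peel f a) (rowOf j))
peel-shift {m} {f} S last-nonempty i₀ {a} refl j with toℕ j <? toℕ i₀
... | yes j<i₀ rewrite toℕ-punchIn-< i₀ j j<i₀ | peel-< f {a} {rowOf j} (s≤s j<i₀) = refl
... | no  j≮i₀ rewrite toℕ-punchIn-≥ i₀ j (≮⇒≥ j≮i₀) | peel-≥ f {a} {rowOf j} (s≤s (≮⇒≥ j≮i₀)) =
  one-step (≤-trans last-nonempty (Shape.antitone S (s≤s z≤n) (s≤s (toℕ<n j))))
  where
  one-step : ∀ {r n} → 1 ≤ n → suc r + pred n ≡ r + n
  one-step {r} {suc n} _ = sym (+-suc r n)

module EmptyLastRow {m f} (S : Shape (suc m) f) (empty : f (suc m) ≡ 0) (T : Tableau f) where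
  open Tableau T

  private
    no-start : ¬ SomeStartsOn hookList (rowEnd f (rowOf (fromℕ m)))
    no-start = subst (λ r → ¬ SomeStartsOn hookList (rowEnd f r)) (sym (rowOf-fromℕ m))
                 (empty-last-row-no-start S empty (All.lookup allInside))

    module R {σ σ′} (σ-lastAt : LastAt (fromℕ m) σ σ′) =
      Restriction {f′ = f} (Shape.antitone S) {hookList} {hookList} {[]} inj₂ (λ H∈ → H∈)
                  (fromℕ m) (λ ()) (same-shift m f) σ-lastAt

    last-row-diagonal : ∀ s → SameDiagonal (rowEnd f (rowOf (fromℕ m))) (s , 0) ⇔ s ≡ suc m
    last-row-diagonal s rewrite toℕ-fromℕ m | empty | +-identityʳ s | +-identityʳ m = mk⇔ sym sym

  last-fixed : ∀ {σ} → PermOf hookList f σ → σ ⟨$⟩ʳ fromℕ m ≡ fromℕ m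
  last-fixed (_ , rows-fit) with rows-fit (fromℕ m)
  ... | inj₂ some        = ⊥-elim (no-start some)
  ... | inj₁ (_ , s-diag) =
    toℕ-injective (suc-injective (trans (Equivalence.to (last-row-diagonal _) s-diag) (sym (rowOf-fromℕ m))))

  add : ∀ {σ σ′} → LastAt (fromℕ m) σ σ′ → PermOf hookList f σ′ → PermOf hookList f σ
  add σ-lastAt perm′ =
    R.extend σ-lastAt perm′ (λ ()) (inj₁ (no-start , Equivalence.from (last-row-diagonal _) (LastAt.row-at-i σ-lastAt)))

  drop : ∀ {σ} → PermOf hookList f σ → PermOf hookList f (remove (fromℕ m) σ)
  drop {σ} perm = R.restrict (remove-lastAt _ σ (last-fixed perm)) corner-free terminal-col perm
    where
    corner-free : ∀ {H} → H ∈ hookList → ¬ (suc m , 1) ∈ H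
    corner-free H∈ corner∈ = <⇒≱ (proj₂ (All.lookup allInside H∈ _ corner∈)) (≤-reflexive empty)

index-of-last-hook : ∀ {m f} → Antitone⁺ f → ∀ {hs H₀ a} {σ : Permutation′ (suc m)} →
                     PermOf hs f σ → H₀ ∈ hs → 1 ≤ a → IsInitial H₀ (a , f a) → IsTerminal H₀ (suc m , 1) →
                     Σ (Fin (suc m)) λ i₀ → rowOf i₀ ≡ a × σ ⟨$⟩ʳ i₀ ≡ fromℕ m
index-of-last-hook {m} {f} antitone {a = a} (hooks-fit , _) H₀∈ 1≤a initial terminal
  with hooks-fit H₀∈
... | i , hookFits (c , c-init , c~) (t , t-term , t-row) _
  rewrite initial-unique c-init initial | terminal-unique t-term terminal =
  i , sym i-row , toℕ-injective (suc-injective (trans (sym t-row) (sym (rowOf-fromℕ m))))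
  where
  i-row : a ≡ rowOf i
  i-row = rowEnd-diagonal-injective antitone 1≤a (s≤s z≤n) c~

module LastRowHook {m f} (S : Shape (suc m) f) (last-nonempty : 1 ≤ f (suc m))
  {hs hs₀ : List (List Cell)} {H₀ : List Cell}
  (split : ∀ {H} → H ∈ hs → H ≡ H₀ ⊎ H ∈ hs₀) (rest-⊆ : ∀ {H} → H ∈ hs₀ → H ∈ hs) (H₀∈ : H₀ ∈ hs)
  {a} (initial : IsInitial H₀ (a , f a)) (terminal : IsTerminal H₀ (suc m , 1))
  (length-H₀ : length H₀ + a ≡ f a + suc m)
  (i₀ : Fin (suc m)) (i₀-row : rowOf i₀ ≡ a) where

  private
    starts : StartsOn H₀ (rowEnd f (rowOf i₀))
    starts = (a , f a) , initial , subst (λ r → a + f r ≡ r + f a) (sym i₀-row) refl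

    split′ : ∀ {H} → H ∈ hs → H ∈ H₀ ∷ [] ⊎ H ∈ hs₀
    split′ H∈ = [ (λ H≡H₀ → inj₁ (here H≡H₀)) , inj₂ ]′ (split H∈)

    H₀-starts : ∀ {H} → H ∈ H₀ ∷ [] → StartsOn H (rowEnd f (rowOf i₀))
    H₀-starts (here refl) = starts

    module R {σ σ′} (σ-lastAt : LastAt i₀ σ σ′) =
      Restriction {f′ = peel f a} (Shape.antitone S) split′ rest-⊆
                  i₀ H₀-starts (peel-shift S last-nonempty i₀ i₀-row) σ-lastAt

  add : ∀ {σ σ′} → LastAt i₀ σ σ′ → PermOf hs₀ (peel f a) σ′ → PermOf hs f σ
  add {σ} σ-lastAt perm′ = R.extend σ-lastAt perm′ (λ { (here refl) → fits }) (inj₂ (H₀ , H₀∈ , starts))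
    where
    length-diag : SameDiagonal (rowEnd f (rowOf i₀)) (rowOf (σ ⟨$⟩ʳ i₀) , length H₀)
    length-diag = begin
      rowOf i₀ + length H₀             ≡⟨ cong (_+ length H₀) i₀-row ⟩
      a + length H₀                    ≡⟨ +-comm a (length H₀) ⟩
      length H₀ + a                    ≡⟨ length-H₀ ⟩
      f a + suc m                      ≡⟨ +-comm (f a) (suc m) ⟩
      suc m + f a                      ≡⟨ cong₂ _+_ (sym (LastAt.row-at-i σ-lastAt)) (cong f (sym i₀-row)) ⟩
      rowOf (σ ⟨$⟩ʳ i₀) + f (rowOf i₀) ∎
      where open ≡-Reasoning
    fits : HookFitsAt f σ i₀ H₀
    fits = hookFits starts (_ , terminal , sym (LastAt.row-at-i σ-lastAt)) length-diag

  remove-last-hook : ∀ {σ} → (∀ {H} → H ∈ hs₀ → ¬ (suc m , 1) ∈ H) → (∀ {H t} → H ∈ hs₀ → IsTerminal H t → col t ≡ 1) →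
                     σ ⟨$⟩ʳ i₀ ≡ fromℕ m → PermOf hs f σ → PermOf hs₀ (peel f a) (remove i₀ σ)
  remove-last-hook {σ} corner-free terminal-col σi₀≡ = R.restrict (remove-lastAt i₀ σ σi₀≡) corner-free terminal-col

no-hooks : ∀ {f} → Shape 0 f → (T : Tableau f) → ∀ {H} → ¬ H ∈ Tableau.hookList T
no-hooks S T H∈ =
  let (c , c∈) = proj₁ (proj₂ (All.lookup (Tableau.allRimHooks T) H∈))
      (1≤row , row≤0) = ShapeGeometry.inShape-rows S (All.lookup (Tableau.allInside T) H∈ c c∈)
  in <⇒≱ 1≤row row≤0

row-index : ∀ {m a} → 1 ≤ a → a ≤ suc m → Σ (Fin (suc m)) λ i → rowOf i ≡ a
row-index {a = suc a} _ a<ℓ = fromℕ< a<ℓ , cong suc (toℕ-fromℕ< a<ℓ)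

module PeelTableau {m f} (S : Shape (suc m) f) (last-nonempty : 1 ≤ f (suc m)) (T : Tableau f) where
  open Tableau T
  open LastHook S last-nonempty T public

  private
    module Rows (i₀ : Fin (suc m)) (i₀-row : rowOf i₀ ≡ a₀) =
      LastRowHook S last-nonempty {hookList} {otherHooks} {H₀} hook-cases (λ H∈ → proj₁ (otherHook H∈)) H₀∈ {a₀}
                  last-hook-initial last-hook-terminal length-last-hook i₀ i₀-row

  add-last-hook : ∀ {i₀ σ σ′} → rowOf i₀ ≡ a₀ → LastAt i₀ σ σ′ → PermOf otherHooks (peel f a₀) σ′ → PermOf hookList f σ
  add-last-hook {i₀} i₀-row = Rows.add i₀ i₀-row

  last-hook-index : ∀ {σ} → PermOf hookList f σ → Σ (Fin (suc m)) λ i₀ → rowOf i₀ ≡ a₀ × σ ⟨$⟩ʳ i₀ ≡ fromℕ m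
  last-hook-index perm = index-of-last-hook (Shape.antitone S) perm H₀∈ 1≤a₀ last-hook-initial last-hook-terminal

  remove-last-hook : ∀ {σ} (perm : PermOf hookList f σ) →
                     PermOf otherHooks (peel f a₀) (remove (proj₁ (last-hook-index perm)) σ)
  remove-last-hook {σ} perm =
    Rows.remove-last-hook (proj₁ (last-hook-index perm)) (proj₁ (proj₂ (last-hook-index perm))) {σ}
      (λ H∈ → proj₂ (otherHook H∈)) (λ H∈ → terminal-col (proj₁ (otherHook H∈)))
      (proj₂ (proj₂ (last-hook-index perm))) perm

perm-exists : ∀ ℓ {f} → Shape ℓ f → (T : Tableau f) → Σ (Permutation′ ℓ) (PermOf (Tableau.hookList T) f)
perm-exists zero S T = Perm.id , (λ H∈ → ⊥-elim (no-hooks S T H∈)) , λ ()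
perm-exists (suc m) {f} S T with 1 ≤? f (suc m)
... | no ¬nonempty =
  let empty = n<1⇒n≡0 (≰⇒> ¬nonempty)
      (σ′ , perm′) = perm-exists m (drop-empty-row S empty) T
  in insert (fromℕ m) (fromℕ m) σ′ , EmptyLastRow.add S empty T (insert-lastAt _ σ′) perm′
... | yes last-nonempty =
  let open PeelTableau S last-nonempty T
      (σ′ , perm′) = perm-exists m (peel-shape S 1≤a₀ a₀≤ℓ) peeled
      (i₀ , i₀-row) = row-index 1≤a₀ a₀≤ℓ
  in insert i₀ (fromℕ m) σ′ , add-last-hook i₀-row (insert-lastAt i₀ σ′) perm′

perm-injective : ∀ ℓ {f} → Shape ℓ f → (T T′ : Tableau f) (σ : Permutation′ ℓ) →
  PermOf (Tableau.hookList T) f σ → PermOf (Tableau.hookList T′) f σ →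
  ∀ {H} → H ∈ Tableau.hookList T → Σ (List Cell) λ H′ → H′ ∈ Tableau.hookList T′ × SameCells H H′
perm-injective zero S T T′ σ _ _ H∈ = ⊥-elim (no-hooks S T H∈)
perm-injective (suc m) {f} S T T′ σ perm perm′ with 1 ≤? f (suc m)
... | no ¬nonempty =
  let empty = n<1⇒n≡0 (≰⇒> ¬nonempty) in
  perm-injective m (drop-empty-row S empty) T T′ (remove (fromℕ m) σ)
    (EmptyLastRow.drop S empty T perm) (EmptyLastRow.drop S empty T′ perm′)
... | yes last-nonempty = same-hooks
  where
  module L  = PeelTableau S last-nonempty T
  module L′ = PeelTableau S last-nonempty T′

  same-index : proj₁ (L.last-hook-index perm) ≡ proj₁ (L′.last-hook-index perm′)
  same-index = trans (sym (inverseˡ σ)) (trans (cong (σ ⟨$⟩ˡ_) σi₀≡σi₀′) (inverseˡ σ))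
    where
    σi₀≡σi₀′ : σ ⟨$⟩ʳ proj₁ (L.last-hook-index perm) ≡ σ ⟨$⟩ʳ proj₁ (L′.last-hook-index perm′)
    σi₀≡σi₀′ = trans (proj₂ (proj₂ (L.last-hook-index perm))) (sym (proj₂ (proj₂ (L′.last-hook-index perm′))))

  same-start : L.a₀ ≡ L′.a₀
  same-start = trans (sym (proj₁ (proj₂ (L.last-hook-index perm))))
                     (trans (cong rowOf same-index) (proj₁ (proj₂ (L′.last-hook-index perm′))))

  same-last-hook : SameCells L.H₀ L′.H₀
  same-last-hook c = mk⇔
    (λ c∈ → let (c-in , c-rim , a₀≤c) = Equivalence.to L.last-hook-cells c∈
            in Equivalence.from L′.last-hook-cells (c-in , c-rim , subst (_≤ row c) same-start a₀≤c))
    (λ c∈ → let (c-in , c-rim , a₀≤c) = Equivalence.to L′.last-hook-cells c∈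
            in Equivalence.from L.last-hook-cells (c-in , c-rim , subst (_≤ row c) (sym same-start) a₀≤c))

  same-rest : ∀ {a a′ i i′} → a ≡ a′ → i ≡ i′ → 1 ≤ a → a ≤ suc m →
              (T₀ : Tableau (peel f a)) (T₀′ : Tableau (peel f a′)) →
              PermOf (Tableau.hookList T₀) (peel f a) (remove i σ) →
              PermOf (Tableau.hookList T₀′) (peel f a′) (remove i′ σ) →
              ∀ {H} → H ∈ Tableau.hookList T₀ → Σ (List Cell) λ H′ → H′ ∈ Tableau.hookList T₀′ × SameCells H H′
  same-rest refl refl 1≤a a≤ℓ T₀ T₀′ = perm-injective m (peel-shape S 1≤a a≤ℓ) T₀ T₀′ _

  same-hooks : ∀ {H} → H ∈ Tableau.hookList T → Σ (List Cell) λ H′ → H′ ∈ Tableau.hookList T′ × SameCells H H′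
  same-hooks H∈ with L.hook-cases H∈
  ... | inj₁ refl = L′.H₀ , L′.H₀∈ , same-last-hook
  ... | inj₂ H∈rest =
    let (H′ , H′∈ , same) = same-rest same-start same-index L.1≤a₀ L.a₀≤ℓ L.peeled L′.peeled
                              (L.remove-last-hook perm) (L′.remove-last-hook perm′) H∈rest
    in H′ , proj₁ (L′.otherHook H′∈) , same

-- f r − r + σ r ≥ 0, i.e. (σ r , 0) lies on or beyond the diagonal of the row end (r , f r)
Admissibleᶠ : (ℕ → ℕ) → ∀ {ℓ} → Permutation′ ℓ → Set
Admissibleᶠ f σ = ∀ i → rowEnd f (rowOf i) ≼ (rowOf (σ ⟨$⟩ʳ i) , 0)

permOf-admissible : ∀ {f} → Antitone⁺ f → ∀ {hs ℓ} {σ : Permutation′ ℓ} → PermOf hs f σ → Admissibleᶠ f σ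
permOf-admissible antitone perm i with proj₂ perm i
... | inj₁ (_ , s-diag)       = mk≼ (≤-reflexive s-diag)
... | inj₂ (H , H∈ , start) =
  mk≼ (≤-trans (+-monoʳ-≤ (rowOf i) z≤n) (≤-reflexive (HookFitsAt.length-on-diagonal (fits-at antitone perm H∈ start))))

admissible-restrict : ∀ {m f f′} {i₀ : Fin (suc m)} {σ σ′} → LastAt i₀ σ σ′ →
  (∀ j → SameDiagonal (rowEnd f (rowOf (punchIn i₀ j))) (rowEnd f′ (rowOf j))) → Admissibleᶠ f σ → Admissibleᶠ f′ σ′
admissible-restrict {f = f} {f′} {i₀} {σ} {σ′} σ-lastAt shift admissible j =
  ≼-trans (mk≼ (≤-reflexive (sym (shift j))))
          (subst (λ s → rowEnd f (rowOf (punchIn i₀ j)) ≼ (s , 0)) (LastAt.row-elsewhere σ-lastAt j)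
                 (admissible (punchIn i₀ j)))

empty-tableau : ∀ {f} → Shape 0 f → Tableau f
empty-tableau {f} S = mkTableau [] [] [] [] nothing-to-cover []
  where
  nothing-to-cover : ∀ c → InShape f c → Σ (List Cell) λ H → H ∈ [] × c ∈ H
  nothing-to-cover c c-in = let (1≤row , row≤0) = ShapeGeometry.inShape-rows S c-in in ⊥-elim (<⇒≱ 1≤row row≤0)

module ExtendByOuterRim {m f} (S : Shape (suc m) f) (last-nonempty : 1 ≤ f (suc m))
                        (a : ℕ) (1≤a : 1 ≤ a) (a≤ℓ : a ≤ suc m) (T₀ : Tableau (peel f a)) where
  open OuterRimDecomposition S last-nonempty a 1≤a a≤ℓ
  open Tableau T₀

  extended : Tableau f
  extended = mkTableau (outerRim ∷ hookList) (outerRim-rimHook ∷ allRimHooks) ((suc m , outerRim-last) ∷ allSpecial)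
    ((λ c c∈ → proj₁ (outerRim-sound c∈)) ∷ All.map (λ inside c c∈ → proj₁ (inPeel⇒ (inside c c∈))) allInside)
    cover (All.tabulate (λ H∈ c c∈rim c∈H → peel-∉-outerRim (All.lookup allInside H∈ c c∈H) c∈rim) ∷ pairwiseDisjoint)
    where
    cover : ∀ c → InShape f c → Σ (List Cell) λ H → H ∈ outerRim ∷ hookList × c ∈ H
    cover c c-in with outerRim-or-peel c-in
    ... | inj₁ c∈rim = outerRim , here refl , c∈rim
    ... | inj₂ c-in′ = let (H , H∈ , c∈) = covering c c-in′ in H , there H∈ , c∈

  add-outer-rim : ∀ {i₀ σ σ′} → rowOf i₀ ≡ a → LastAt i₀ σ σ′ →
                  PermOf hookList (peel f a) σ′ → PermOf (outerRim ∷ hookList) f σ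
  add-outer-rim {i₀} i₀-row =
    LastRowHook.add S last-nonempty {outerRim ∷ hookList} {hookList} {outerRim} split there (here refl) {a}
      outerRim-initial outerRim-terminal length-outerRim i₀ i₀-row
    where
    split : ∀ {H} → H ∈ outerRim ∷ hookList → H ≡ outerRim ⊎ H ∈ hookList
    split (here H≡) = inj₁ H≡
    split (there H∈) = inj₂ H∈

perm-surjective : ∀ ℓ {f} → Shape ℓ f → (σ : Permutation′ ℓ) → Admissibleᶠ f σ →
                  Σ (Tableau f) λ T → PermOf (Tableau.hookList T) f σ
perm-surjective zero S σ _ = empty-tableau S , (λ ()) , (λ ())
perm-surjective (suc m) {f} S σ admissible with 1 ≤? f (suc m)
... | no ¬nonempty =
  let empty = n<1⇒n≡0 (≰⇒> ¬nonempty)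
      σ-lastAt = remove-lastAt (fromℕ m) σ (last-fixed empty)
      (T , perm′) = perm-surjective m (drop-empty-row S empty) (remove (fromℕ m) σ)
                                    (admissible-restrict {f = f} {f} σ-lastAt (same-shift m f) admissible)
  in T , EmptyLastRow.add S empty T σ-lastAt perm′
  where
  last-fixed : f (suc m) ≡ 0 → σ ⟨$⟩ʳ fromℕ m ≡ fromℕ m
  last-fixed empty = rowOf-injective (trans (≤-antisym (toℕ<n (σ ⟨$⟩ʳ fromℕ m)) reaches-last) (sym (rowOf-fromℕ m)))
    where
    reaches-last : suc m ≤ rowOf (σ ⟨$⟩ʳ fromℕ m)
    reaches-last = subst₂ _≤_ (trans (+-identityʳ _) (rowOf-fromℕ m))
                              (trans (cong (λ x → rowOf (σ ⟨$⟩ʳ fromℕ m) + x) (trans (cong f (rowOf-fromℕ m)) empty))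
                                     (+-identityʳ _))
                              (cross (admissible (fromℕ m)))
... | yes last-nonempty =
  let i₀ = σ ⟨$⟩ˡ fromℕ m
      σ-lastAt = remove-lastAt i₀ σ (inverseʳ σ)
      (T₀ , perm₀) = perm-surjective m (peel-shape S (s≤s z≤n) (toℕ<n i₀)) (remove i₀ σ)
                                     (admissible-restrict {f = f} {peel f (rowOf i₀)} σ-lastAt
                                                          (peel-shift S last-nonempty i₀ refl) admissible)
      open ExtendByOuterRim S last-nonempty (rowOf i₀) (s≤s z≤n) (toℕ<n i₀) T₀
  in extended , add-outer-rim refl σ-lastAt perm₀

ℤ-difference-≡ : ∀ p q r s → (+ p ℤ.- + q ≡ + r ℤ.- + s) ⇔ (p + s ≡ r + q)
ℤ-difference-≡ p q r s = mk⇔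
  (λ eq → ℤ.+-injective (begin
    + (p + s)                   ≡⟨ regroup (+ p) (+ q) (+ s) ⟩
    (+ p ℤ.- + q) ℤ.+ (+ q ℤ.+ + s) ≡⟨ cong (ℤ._+ (+ q ℤ.+ + s)) eq ⟩
    (+ r ℤ.- + s) ℤ.+ (+ q ℤ.+ + s) ≡⟨ regroup′ (+ r) (+ q) (+ s) ⟩
    + (r + q)                   ∎))
  (λ eq → begin
    + p ℤ.- + q                     ≡⟨ widen (+ p) (+ q) (+ s) ⟩
    (+ p ℤ.+ + s) ℤ.- (+ q ℤ.+ + s) ≡⟨ cong (λ x → x ℤ.- (+ q ℤ.+ + s)) (cong +_ eq) ⟩
    (+ r ℤ.+ + q) ℤ.- (+ q ℤ.+ + s) ≡⟨ narrow (+ r) (+ q) (+ s) ⟩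
    + r ℤ.- + s                     ∎)
  where
  open ≡-Reasoning
  regroup : ∀ P Q S → P ℤ.+ S ≡ (P ℤ.- Q) ℤ.+ (Q ℤ.+ S)
  regroup = ℤ-Solver.solve-∀
  regroup′ : ∀ R Q S → (R ℤ.- S) ℤ.+ (Q ℤ.+ S) ≡ R ℤ.+ Q
  regroup′ = ℤ-Solver.solve-∀
  widen : ∀ P Q S → P ℤ.- Q ≡ (P ℤ.+ S) ℤ.- (Q ℤ.+ S)
  widen = ℤ-Solver.solve-∀
  narrow : ∀ R Q S → (R ℤ.+ Q) ℤ.- (Q ℤ.+ S) ≡ R ℤ.- S
  narrow = ℤ-Solver.solve-∀

difference-+ : ∀ p q s → (+ p ℤ.- + q) ℤ.+ + s ≡ + (p + s) ℤ.- + q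
difference-+ p q s = regroup (+ p) (+ q) (+ s)
  where
  regroup : ∀ P Q S → (P ℤ.- Q) ℤ.+ S ≡ (P ℤ.+ S) ℤ.- Q
  regroup = ℤ-Solver.solve-∀

difference-zero : ∀ g → + g ≡ + g ℤ.- + 0
difference-zero g = sym (ℤ.+-identityʳ (+ g))

onDiagonal⇔ : ∀ λ′ r c → OnDiagonal (diagIndex λ′ r) c ⇔ SameDiagonal c (rowEnd (rowLen λ′) r)
onDiagonal⇔ λ′ r (a , b) =
  let fr = rowLen λ′ r
      one-more : ∀ p q → (+ p ℤ.- + q) ℤ.+ + 1 ≡ + suc p ℤ.- + q
      one-more p q = trans (difference-+ p q 1) (cong (λ x → + x ℤ.- + q) (+-comm p 1))
      module D = Equivalence (ℤ-difference-≡ (suc a) b (suc r) fr)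
  in mk⇔ (λ on → suc-injective (D.to (trans (sym (one-more a b)) (trans on (one-more r fr)))))
         (λ same → trans (one-more a b) (trans (D.from (cong suc same)) (sym (one-more r fr))))

length-on-diagonal⇔ : ∀ fr r s g → SameDiagonal (r , fr) (s , g) ⇔ (+ g ≡ (+ fr ℤ.- + r) ℤ.+ + s)
length-on-diagonal⇔ fr r s g =
  let module D = Equivalence (ℤ-difference-≡ g 0 (fr + s) r)
  in mk⇔ (λ same → trans (difference-zero g) (trans (D.from (trans (+-comm g r) (trans same (trans (+-comm s fr) (+-comm 0 (fr + s))))))
                                                      (sym (difference-+ fr r s))))
         (λ eq → trans (+-comm r g) (trans (D.to (trans (sym (difference-zero g)) (trans eq (difference-+ fr r s))))
                                            (trans (+-comm (fr + s) 0) (+-comm fr s))))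

permRow⇔ : ∀ s r fr → (+ s ≡ + r ℤ.- + fr) ⇔ SameDiagonal (r , fr) (s , 0)
permRow⇔ s r fr =
  let module D = Equivalence (ℤ-difference-≡ s 0 r fr)
  in mk⇔ (λ eq → sym (D.to (trans (sym (difference-zero s)) eq)))
         (λ same → trans (difference-zero s) (D.from (sym same)))

admissible⇔ : ∀ fr r s → (+ 0 ℤ.≤ (+ fr ℤ.- + r) ℤ.+ + s) ⇔ (r , fr) ≼ (s , 0)
admissible⇔ fr r s = mk⇔
  (λ 0≤ → mk≼ (subst₂ _≤_ (sym (+-identityʳ r)) (+-comm fr s)
                 (ℤ.drop‿+≤+ (ℤ.0≤i-j⇒j≤i (subst (+ 0 ℤ.≤_) (difference-+ fr r s) 0≤)))))
  (λ r≼ → subst (+ 0 ℤ.≤_) (sym (difference-+ fr r s))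
            (ℤ.i≤j⇒0≤j-i (ℤ.+≤+ (subst₂ _≤_ (+-identityʳ r) (+-comm s fr) (cross r≼)))))

Disjointᵢ : List (List Cell) → Set
Disjointᵢ hs = ∀ c (k k′ : Fin (length hs)) → c ∈ lookup hs k → c ∈ lookup hs k′ → k ≡ k′

disjointᵢ⇒allPairs : ∀ hs → Disjointᵢ hs → AllPairs Disjoint hs
disjointᵢ⇒allPairs []       _     = []
disjointᵢ⇒allPairs (H ∷ hs) disj =
  All.tabulate (λ H′∈ c c∈H c∈H′ →
    Fin.0≢1+n (disj c Fin.zero (Fin.suc (Any.index H′∈)) c∈H (subst (c ∈_) (lookup-index H′∈) c∈H′)))
  ∷ disjointᵢ⇒allPairs hs (λ c k k′ c∈ c∈′ → Fin.suc-injective (disj c (Fin.suc k) (Fin.suc k′) c∈ c∈′))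

allPairs⇒disjointᵢ : ∀ {hs} → AllPairs Disjoint hs → Disjointᵢ hs
allPairs⇒disjointᵢ (_ ∷ _)        c Fin.zero    Fin.zero     _   _   = refl
allPairs⇒disjointᵢ {_ ∷ hs} (H-disj ∷ _) c Fin.zero    (Fin.suc k′) c∈H c∈′ =
  ⊥-elim (All.lookup H-disj (∈-lookup {xs = hs} k′) c c∈H c∈′)
allPairs⇒disjointᵢ {_ ∷ hs} (H-disj ∷ _) c (Fin.suc k) Fin.zero     c∈  c∈H =
  ⊥-elim (All.lookup H-disj (∈-lookup {xs = hs} k) c c∈H c∈)
allPairs⇒disjointᵢ (_ ∷ pairs)    c (Fin.suc k) (Fin.suc k′) c∈  c∈′ = cong Fin.suc (allPairs⇒disjointᵢ pairs c k k′ c∈ c∈′)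

toTableau : ∀ {λ′} → SRT λ′ → Tableau (rowLen λ′)
toTableau R = mkTableau (hooks R) (rimHook R) (special R) (inShape R)
  (λ c c-in → let (k , c∈) = covered R c c-in in lookup (hooks R) k , ∈-lookup k , c∈)
  (disjointᵢ⇒allPairs (hooks R) (disjoint R))

fromTableau : ∀ {λ′} → Tableau (rowLen λ′) → SRT λ′
fromTableau T = record
  { hooks    = hookList
  ; rimHook  = allRimHooks
  ; special  = allSpecial
  ; inShape  = allInside
  ; covered  = λ c c-in → let (H , H∈ , c∈) = covering c c-in in Any.index H∈ , subst (c ∈_) (lookup-index H∈) c∈
  ; disjoint = allPairs⇒disjointᵢ pairwiseDisjoint
  }
  where open Tableau T

module ForPartition {λ′ : List ℕ} (partition : IsPartition λ′) where
  f = rowLen λ′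
  ℓ = length λ′
  S = partition-shape partition

  startsOn⇒ : ∀ (R : SRT λ′) r → HasInitialOn R (diagIndex λ′ r) → SomeStartsOn (hooks R) (rowEnd f r)
  startsOn⇒ R r (k , c , init , on) = lookup (hooks R) k , ∈-lookup k , c , init , Equivalence.to (onDiagonal⇔ λ′ r c) on

  startsOn⇐ : ∀ (R : SRT λ′) r → SomeStartsOn (hooks R) (rowEnd f r) → HasInitialOn R (diagIndex λ′ r)
  startsOn⇐ R r (H , H∈ , c , init , same) =
    Any.index H∈ , c , subst (λ X → IsInitial X c) (lookup-index H∈) init , Equivalence.from (onDiagonal⇔ λ′ r c) same

  hook-fits : ∀ (R : SRT λ′) {σ : Permutation′ ℓ} i k {c} → PermOf (hooks R) f σ → InitialOn R (diagIndex λ′ (rowOf i)) k c →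
              HookFitsAt f σ i (lookup (hooks R) k)
  hook-fits R {σ} i k {c} perm (init , on) =
    fits-at (Shape.antitone S) {σ = σ} perm (∈-lookup k) (c , init , Equivalence.to (onDiagonal⇔ λ′ (rowOf i) c) on)

  admissible⇔ᶠ : ∀ {σ : Permutation′ ℓ} → Admissible λ′ σ ⇔ Admissibleᶠ f σ
  admissible⇔ᶠ {σ} = mk⇔ (λ adm i → Equivalence.to (admissible⇔ (f (rowOf i)) _ (rowOf (σ ⟨$⟩ʳ i))) (adm i))
                         (λ adm i → Equivalence.from (admissible⇔ (f (rowOf i)) _ (rowOf (σ ⟨$⟩ʳ i))) (adm i))

  permSRT : ∀ (R : SRT λ′) {σ : Permutation′ ℓ} → PermOf (hooks R) f σ → PermSRT λ′ R σ
  permSRT R perm i with proj₂ perm i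
  ... | inj₁ (none , s-diag) = inj₁ (none ∘ startsOn⇒ R (rowOf i) , Equivalence.from (permRow⇔ _ _ _) s-diag)
  ... | inj₂ (H , H∈ , start@(c , init , same)) =
    let (t , term , row-t) = HookFitsAt.ends-in-row (fits-at (Shape.antitone S) perm H∈ start)
    in inj₂ ( Any.index H∈ , c , t
            , (subst (λ X → IsInitial X c) (lookup-index H∈) init , Equivalence.from (onDiagonal⇔ λ′ (rowOf i) c) same)
            , subst (λ X → IsTerminal X t) (lookup-index H∈) term , cong +_ (sym row-t))

  permSRT-determines : ∀ (R : SRT λ′) {σ τ : Permutation′ ℓ} → PermOf (hooks R) f τ → PermSRT λ′ R σ →
                       ∀ i → σ ⟨$⟩ʳ i ≡ τ ⟨$⟩ʳ i
  permSRT-determines R {σ} {τ} perm p i with p i | proj₂ perm i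
  ... | inj₁ (_ , eq) | inj₁ (_ , s-diag) =
    rowOf-injective (+-cancelʳ-≡ (f (rowOf i)) _ _ (trans (sym (Equivalence.to (permRow⇔ _ _ _) eq)) s-diag))
  ... | inj₁ (none , _) | inj₂ some = ⊥-elim (none (startsOn⇐ R (rowOf i) some))
  ... | inj₂ (k , c , t , initial-on , term , eq) | _ =
    let (t′ , term′ , row-t′) = HookFitsAt.ends-in-row (hook-fits R {τ} i k perm initial-on)
    in rowOf-injective (trans (ℤ.+-injective eq) (trans (cong row (terminal-unique term term′)) row-t′))

  permOf : ∀ (R : SRT λ′) {σ : Permutation′ ℓ} → PermSRT λ′ R σ → PermOf (hooks R) f σ
  permOf R {σ} p =
    let (σR , permR) = perm-exists ℓ S (toTableau R)
    in permOf-cong {σ = σR} {σ} (λ i → sym (permSRT-determines R {σ} permR p i)) permR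

  same-hooks : ∀ (R R′ : SRT λ′) σ → PermSRT λ′ R σ → PermSRT λ′ R′ σ →
               ∀ {H} → H ∈ hooks R → Σ (List Cell) λ H′ → H′ ∈ hooks R′ × SameCells H H′
  same-hooks R R′ σ p p′ = perm-injective ℓ S (toTableau R) (toTableau R′) σ (permOf R p) (permOf R′ p′)

  gamma : ∀ (R : SRT λ′) {σ : Permutation′ ℓ} → PermSRT λ′ R σ → ∀ i g →
          GammaIs λ′ R (rowOf i) g ⇔ (+ g ≡ (+ f (rowOf i) ℤ.- + rowOf i) ℤ.+ + rowOf (σ ⟨$⟩ʳ i))
  gamma R {σ} p i g = length-on-diagonal⇔ (f r) r (rowOf (σ ⟨$⟩ʳ i)) g ⇔-∘ mk⇔ to from
    where
    r = rowOf i
    perm = permOf R p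
    to : GammaIs λ′ R r g → SameDiagonal (rowEnd f r) (rowOf (σ ⟨$⟩ʳ i) , g)
    to (inj₁ (none , refl)) with proj₂ perm i
    ... | inj₁ (_ , s-diag) = s-diag
    ... | inj₂ some = ⊥-elim (none (startsOn⇐ R r some))
    to (inj₂ (k , c , initial-on , refl)) = HookFitsAt.length-on-diagonal (hook-fits R {σ} i k perm initial-on)
    from : SameDiagonal (rowEnd f r) (rowOf (σ ⟨$⟩ʳ i) , g) → GammaIs λ′ R r g
    from same with proj₂ perm i
    ... | inj₁ (none , s-diag) = inj₁ (none ∘ startsOn⇒ R r , +-cancelˡ-≡ r g 0 (trans same (sym s-diag)))
    ... | inj₂ (H , H∈ , start@(c , init , c~)) =
      let length-diag = HookFitsAt.length-on-diagonal (fits-at (Shape.antitone S) perm H∈ start)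
      in inj₂ ( Any.index H∈ , c
              , (subst (λ X → IsInitial X c) (lookup-index H∈) init , Equivalence.from (onDiagonal⇔ λ′ r c) c~)
              , trans (+-cancelˡ-≡ r g _ (trans same (sym length-diag))) (cong length (lookup-index H∈)) )

corollary6p12 : (n : ℕ) (λ′ : List ℕ) → IsPartition λ′ → sum λ′ ≡ n →
  -- perm_SRT is a well-defined map SRT_λ → {σ ∈ S_ℓ : λ_i - i + σ_i ≥ 0}
  ((R : SRT λ′) → Σ (Permutation′ (length λ′)) (λ σ → Admissible λ′ σ × PermSRT λ′ R σ))
  × ((R : SRT λ′) (σ τ : Permutation′ (length λ′)) → PermSRT λ′ R σ → PermSRT λ′ R τ →
       ∀ i → σ ⟨$⟩ʳ i ≡ τ ⟨$⟩ʳ i)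
  -- injective
  × ((R R′ : SRT λ′) (σ : Permutation′ (length λ′)) → PermSRT λ′ R σ → PermSRT λ′ R′ σ →
       R ≈SRT R′)
  -- surjective
  × ((σ : Permutation′ (length λ′)) → Admissible λ′ σ →
       Σ (SRT λ′) (λ R → PermSRT λ′ R σ))
  -- Γ_i(R) = λ_i - i + σ_i
  × ((R : SRT λ′) (σ : Permutation′ (length λ′)) → PermSRT λ′ R σ →
       (i : Fin (length λ′)) (g : ℕ) →
       GammaIs λ′ R (rowOf i) g
         ⇔ (+ g ≡ (+ rowLen λ′ (rowOf i) ℤ.- + rowOf i) ℤ.+ + rowOf (σ ⟨$⟩ʳ i)))
corollary6p12 _ λ′ partition _ =
    (λ R → let (σ , perm) = perm-exists ℓ S (toTableau R)
           in σ , Equivalence.from (admissible⇔ᶠ {σ}) (permOf-admissible (Shape.antitone S) {σ = σ} perm) , permSRT R perm)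
  , (λ R σ τ p q i → let (_ , perm) = perm-exists ℓ S (toTableau R)
                     in trans (permSRT-determines R {σ} perm p i) (sym (permSRT-determines R {τ} perm q i)))
  , (λ R R′ σ p p′ → same-hooks R R′ σ p p′ , same-hooks R′ R σ p′ p)
  , (λ σ admissible → let (T , perm) = perm-surjective ℓ S σ (Equivalence.to (admissible⇔ᶠ {σ}) admissible)
                      in fromTableau T , permSRT (fromTableau T) perm)
  , (λ R σ → gamma R {σ})
  where open ForPartition partition
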